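{- Let $3\le k\le n$ and let $G$ be a unicyclic graph with $n$ vertices whose unique cycle has length $k$. Then $F(G)\le F(G_{k,1}^{(n)})$, with equality if and only if $G\cong G_{k,1}^{(n)}$.
   Context: All graphs are finite and simple. The F-index of a graph $G$ is $F(G)=\sum_{v\in V(G)} d_G(v)^3$. A unicyclic graph is a connected graph with exactly one cycle. $G_{k,1}^{(n)}$ is the graph obtained from the cycle $C_k$ by attaching $n-k$ new leaves (vertices adjacent only to that cycle vertex) to one vertex of the cycle. -}

module Defs where

open import Data.Nat using (ℕ; zero; suc; _≤_; _∸_; _^_; _≡ᵇ_; _<ᵇ_; _≤ᵇ_; s≤s; z≤n)
open import Data.Bool using (Bool; true; false; _∧_; _∨_; if_then_else_)
open import Data.Bool.Properties using (∨-comm)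
open import Data.Fin using (Fin; toℕ)
open import Data.List using (List; map; allFin)
open import Data.Nat.ListAction using (sum)
open import Data.Product using (Σ; ∃; _×_; _,_)
open import Data.Sum using (_⊎_)
open import Function.Bundles using (_↔_; Inverse; _⇔_)
open import Function.Definitions using (Injective)
open import Relation.Binary.PropositionalEquality using (_≡_; refl; cong)

record Graph (n : ℕ) : Set where
  field
    adj    : Fin n → Fin n → Bool
    sym    : ∀ i j → adj i j ≡ adj j i
    irrefl : ∀ i → adj i i ≡ false
open Graph public

degree : ∀ {n} → Graph n → Fin n → ℕ
degree {n} G v = sum (map (λ w → if adj G v w then 1 else 0) (allFin n))

F : ∀ {n} → Graph n → ℕ
F {n} G = sum (map (λ v → degree G v ^ 3) (allFin n))

data Reach {n} (G : Graph n) : Fin n → Fin n → Set where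
  here : ∀ {i} → Reach G i i
  step : ∀ {i l j} → adj G i l ≡ true → Reach G l j → Reach G i j

Connected : ∀ {n} → Graph n → Set
Connected {n} G = ∀ (i j : Fin n) → Reach G i j

Consecutive : (k : ℕ) → Fin k → Fin k → Set
Consecutive k i j = (toℕ j ≡ suc (toℕ i)) ⊎ (suc (toℕ i) ≡ k × toℕ j ≡ 0)

record Cycle {n} (G : Graph n) : Set where
  field
    len    : ℕ
    len≥3  : 3 ≤ len
    vs     : Fin len → Fin n
    inj    : Injective _≡_ _≡_ vs
    closed : ∀ i j → Consecutive len i j → adj G (vs i) (vs j) ≡ true
open Cycle public

CycleEdge : ∀ {n} {G : Graph n} → Cycle G → Fin n → Fin n → Set
CycleEdge c x y = ∃ λ i → ∃ λ j → Consecutive (len c) i j ×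
  ((vs c i ≡ x × vs c j ≡ y) ⊎ (vs c i ≡ y × vs c j ≡ x))

SameCycle : ∀ {n} {G : Graph n} → Cycle G → Cycle G → Set
SameCycle {n} c c' = ∀ (x y : Fin n) → CycleEdge c x y ⇔ CycleEdge c' x y

Unicyclic : ∀ {n} → Graph n → Set
Unicyclic G = Connected G × Cycle G × (∀ (c c' : Cycle G) → SameCycle c c')

_≅_ : ∀ {n} → Graph n → Graph n → Set
_≅_ {n} G H = Σ (Fin n ↔ Fin n) λ σ →
  ∀ i j → adj G i j ≡ adj H (Inverse.to σ i) (Inverse.to σ j)

-- G_{k,1}^{(n)}: vertices 0..k-1 form the cycle C_k (i ~ i+1, k-1 ~ 0);
-- vertices k..n-1 are leaves attached to vertex 0.
gk1base : ℕ → ℕ → ℕ → Bool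
gk1base k a b = ((b ≡ᵇ suc a) ∧ (b <ᵇ k)) ∨ ((a ≡ᵇ 0) ∧ (suc b ≡ᵇ k)) ∨ ((a ≡ᵇ 0) ∧ (k ≤ᵇ b))

private
  ≡ᵇ-suc : ∀ a → (a ≡ᵇ suc a) ≡ false
  ≡ᵇ-suc zero = refl
  ≡ᵇ-suc (suc a) = ≡ᵇ-suc a

  base-irr : ∀ m a → gk1base (suc (suc (suc m))) a a ≡ false
  base-irr m zero = refl
  base-irr m (suc a) rewrite ≡ᵇ-suc a = refl

G[_,1]^ : (k : ℕ) → 3 ≤ k → (n : ℕ) → Graph n
G[ k ,1]^ h n = record
  { adj    = λ i j → gk1base k (toℕ i) (toℕ j) ∨ gk1base k (toℕ j) (toℕ i)
  ; sym    = λ i j → ∨-comm (gk1base k (toℕ i) (toℕ j)) _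
  ; irrefl = irr h
  }
  where
  irr : 3 ≤ k → ∀ (i : Fin n) → (gk1base k (toℕ i) (toℕ i) ∨ gk1base k (toℕ i) (toℕ i)) ≡ false
  irr (s≤s (s≤s (s≤s {n = m} _))) i rewrite base-irr m (toℕ i) = refl

-- Since G is connected on n ≥ 2 vertices, every degree d is at least 1, and
--   d ^ 3 = 1 + 7 [d ≥ 2] + φ (d ∸ 2)   with   φ e = (2 + e) ^ 3 ∸ 8,
-- so F G = n + 7 m + Σ φ (e v), where m counts the vertices of degree at least 2 and
-- e v = degree v ∸ 2.  Deleting an edge of the unique cycle leaves a forest, so G has at
-- most n edges and n + m + Σ e v = Σ degree v ≤ 2 n.  As φ is superadditive,
-- Σ φ (e v) ≤ φ (n ∸ m); the k cycle vertices give m ≥ k, and 7 m + φ (n ∸ m) strictly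
-- decreases in m, whence F G ≤ n + 7 k + φ (n ∸ k) = F (G[ k ,1]^ n).  Equality forces
-- m = k, so every vertex off the cycle is a leaf, and, since
-- φ (a + b) ≥ φ a + φ b + 12 a b, at most one vertex has degree 3 or more.  Connectivity
-- then hangs every leaf on that cycle vertex, which is the shape of G[ k ,1]^ n.

module Submission where

open import Data.Nat.Properties hiding (_≟_)
import Data.Nat.Properties as ℕ
open import Algebra.Properties.CommutativeSemigroup +-commutativeSemigroup using (x∙yz≈y∙xz)
open import Algebra.Properties.Semiring.Sum +-*-semiring using (sum; sum-syntax; sum-cong-≗; sum-replicate-zero; ∑-distrib-+; ∑-comm; ∑-permute; *-distribˡ-sum)
open import Data.Bool.Base using (Bool; true; false; _∧_; _∨_; not; if_then_else_; T)
open import Data.Bool.Properties using (T-≡; T-∧; T-∨; ∧-comm; ∨-comm; ∨-zeroʳ; ⇔→≡)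
import Data.Bool.Properties as Bool
open import Data.Empty using (⊥)
open import Data.Fin.Base using (Fin; zero; suc; toℕ; fromℕ<; fromℕ; inject₁; inject≤)
open import Data.Fin.Properties using (_≟_; toℕ-injective; toℕ<n; toℕ-fromℕ<; toℕ-fromℕ; toℕ-inject₁; toℕ-inject≤; any?)
import Data.Fin.Properties as Fin
open import Data.Fin.Permutation using (Permutation′; _⟨$⟩ʳ_; _⟨$⟩ˡ_; _∘ₚ_; transpose; flip; inverseˡ; inverseʳ) renaming (id to idₚ)
import Data.Fin.Permutation.Components as PC
open import Data.List.Base using (List; []; _∷_; _++_; length; lookup; map; filter; cartesianProduct; allFin; tabulate)
open import Data.List.Properties using (map-++; map-∘; map-cong; map-tabulate)
open import Data.List.Membership.Propositional using (_∈_)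
open import Data.List.Membership.Propositional.Properties using (∈-lookup)
open import Data.List.Relation.Unary.All as All using (All; []; _∷_)
open import Data.List.Relation.Unary.All.Properties using (¬Any⇒All¬; all-filter)
open import Data.List.Relation.Unary.Any using (here; there)
open import Data.List.Relation.Unary.AllPairs using ([]; _∷_)
open import Data.List.Relation.Unary.Unique.Propositional using (Unique)
import Data.List.Relation.Unary.Unique.Propositional.Properties as Unique
open import Data.Nat.Base
import Data.Nat.ListAction as List
open import Data.Nat.ListAction.Properties using (sum-++)
open import Data.Nat.Tactic.RingSolver using (solve-∀)
open import Data.Product.Base using (Σ; _×_; _,_; proj₁; proj₂)
open import Data.Sum.Base using (_⊎_; inj₁; inj₂)
import Data.Sum.Base as Sum
import Data.Vec.Functional as Vec
open import Function.Base using (_∘_; _∘′_; id; _|>_)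
open import Function.Bundles using (_⇔_; mk⇔; Equivalence)
open import Function.Definitions using (Injective)
open import Relation.Binary.Construct.Closure.ReflexiveTransitive using (Star; ε; _◅_; _◅◅_)
import Relation.Binary.Construct.Closure.ReflexiveTransitive as Star
open import Relation.Binary.Definitions using (tri<; tri≈; tri>)
open import Relation.Binary.PropositionalEquality
open import Relation.Nullary.Decidable using (does; yes; no; dec-true; dec-false; _×-dec_)
open import Relation.Nullary.Negation using (¬_; contradiction)
open import Relation.Unary using (Decidable)
open import Defs hiding (sym)

𝟙 : Bool → ℕ
𝟙 b = if b then 1 else 0

𝟙≤1 : ∀ b → 𝟙 b ≤ 1
𝟙≤1 true  = ≤-refl
𝟙≤1 false = z≤n

𝟙-T : ∀ {b} → T b → 𝟙 b ≡ 1
𝟙-T {true} _ = refl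

𝟙-¬T : ∀ {b} → ¬ T b → 𝟙 b ≡ 0
𝟙-¬T {true}  ¬t = contradiction _ ¬t
𝟙-¬T {false} _  = refl

𝟙-∧ : ∀ a b → 𝟙 (a ∧ b) ≡ 𝟙 a * 𝟙 b
𝟙-∧ true  b = sym (+-identityʳ (𝟙 b))
𝟙-∧ false b = refl

𝟙-∨ : ∀ a b → 𝟙 (a ∨ b) ≤ 𝟙 a + 𝟙 b
𝟙-∨ true  b = m≤m+n 1 (𝟙 b)
𝟙-∨ false b = ≤-refl

𝟙-∧-not : ∀ a b → 𝟙 a ≤ 𝟙 (a ∧ not b) + 𝟙 b
𝟙-∧-not true  true  = ≤-refl
𝟙-∧-not true  false = ≤-refl
𝟙-∧-not false b     = z≤n

𝟙-∨-disjoint : ∀ a b → (T a → T b → ⊥) → 𝟙 (a ∨ b) ≡ 𝟙 a + 𝟙 b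
𝟙-∨-disjoint true  true  disjoint = contradiction _ (disjoint _)
𝟙-∨-disjoint true  false _        = refl
𝟙-∨-disjoint false b     _        = refl

𝟙-cong⇔ : ∀ {P : Set} {a b} → T a ⇔ P → T b ⇔ P → 𝟙 a ≡ 𝟙 b
𝟙-cong⇔ {a = true}  {true}  _  _  = refl
𝟙-cong⇔ {a = true}  {false} a⇔ b⇔ = Equivalence.from b⇔ (Equivalence.to a⇔ _) |> λ ()
𝟙-cong⇔ {a = false} {true}  a⇔ b⇔ = Equivalence.from a⇔ (Equivalence.to b⇔ _) |> λ ()
𝟙-cong⇔ {a = false} {false} _  _  = refl

sum-mono-≤ : ∀ {n} {f g : Fin n → ℕ} → (∀ i → f i ≤ g i) → sum f ≤ sum g
sum-mono-≤ {zero}  f≤g = z≤n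
sum-mono-≤ {suc n} f≤g = +-mono-≤ (f≤g zero) (sum-mono-≤ (f≤g ∘ suc))

term≤sum : ∀ {n} (f : Fin n → ℕ) i → f i ≤ sum f
term≤sum f zero    = m≤m+n _ _
term≤sum f (suc i) = ≤-trans (term≤sum (f ∘ suc) i) (m≤n+m _ _)

∑-one : ∀ n → ∑[ i < n ] 1 ≡ n
∑-one zero    = refl
∑-one (suc n) = cong suc (∑-one n)

∑-*ˡ : ∀ {n} c (f : Fin n → ℕ) → ∑[ i < n ] (c * f i) ≡ c * sum f
∑-*ˡ c f = sym (*-distribˡ-sum c f)

δ : ∀ {n} → Fin n → Fin n → ℕ
δ v x = 𝟙 (does (v ≟ x))

∑-δ* : ∀ {n} (x : Fin n) (f : Fin n → ℕ) → ∑[ v < n ] (δ v x * f v) ≡ f x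
∑-δ* {suc n} zero f = begin
  (f zero + 0) + ∑[ v < n ] 0 ≡⟨ cong₂ _+_ (+-identityʳ _) (sum-replicate-zero n) ⟩
  f zero + 0                  ≡⟨ +-identityʳ _ ⟩
  f zero                      ∎
  where open ≡-Reasoning
∑-δ* {suc n} (suc x) f = ∑-δ* x (f ∘ suc)

∑-δ : ∀ {n} (x : Fin n) → ∑[ v < n ] δ v x ≡ 1
∑-δ x = trans (sum-cong-≗ (λ v → sym (*-identityʳ (δ v x)))) (∑-δ* x (λ _ → 1))

∑-split-at : ∀ {n} (u : Fin n) (f : Fin n → ℕ) →
  sum f ≡ f u + ∑[ v < n ] (if does (v ≟ u) then 0 else f v)
∑-split-at zero    f = refl
∑-split-at (suc u) f =
  trans (cong (f zero +_) (∑-split-at u (f ∘ suc))) (x∙yz≈y∙xz (f zero) (f (suc u)) _)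

count : ∀ {n} → (Fin n → Bool) → ℕ
count {n} p = ∑[ v < n ] 𝟙 (p v)

count≤n : ∀ {n} (p : Fin n → Bool) → count p ≤ n
count≤n {n} p = ≤-trans (sum-mono-≤ (𝟙≤1 ∘ p)) (≤-reflexive (∑-one n))

count-none : ∀ {n} (p : Fin n → Bool) → (∀ v → p v ≡ false) → count p ≡ 0
count-none {n} p none = trans (sum-cong-≗ (cong 𝟙 ∘ none)) (sum-replicate-zero n)

count-unique : ∀ {n} (p : Fin n → Bool) →
  (∀ v w → p v ≡ true → p w ≡ true → v ≡ w) → count p ≤ 1
count-unique {zero}  p unique = z≤n
count-unique {suc n} p unique with p zero in p0
... | true  = ≤-reflexive (cong suc (count-none (p ∘ suc) others-false))
  where
  others-false : ∀ v → p (suc v) ≡ false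
  others-false v with p (suc v) in pv
  ... | true  with () ← unique zero (suc v) p0 pv
  ... | false = refl
... | false = count-unique (p ∘ suc) (λ v w pv pw → Fin.suc-injective (unique (suc v) (suc w) pv pw))

count≥1⇒∃ : ∀ {n} (p : Fin n → Bool) → 1 ≤ count p → Σ (Fin n) λ v → p v ≡ true
count≥1⇒∃ {suc n} p h with p zero in p0
... | true  = zero , p0
... | false with count≥1⇒∃ (p ∘ suc) h
... | v , pv = suc v , pv

≟-does⇒≡ : ∀ {n} {x y : Fin n} → does (x ≟ y) ≡ true → x ≡ y
≟-does⇒≡ {x = x} {y} e with x ≟ y | e
... | yes x≡y | _ = x≡y

injection⇒≤count : ∀ {j n} (p : Fin n → Bool) (f : Fin j → Fin n) → Injective _≡_ _≡_ f →
  (∀ i → p (f i) ≡ true) → j ≤ count p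
injection⇒≤count {j} {n} p f f-inj p∘f = begin
  j                                ≡⟨ sym (∑-one j) ⟩
  ∑[ i < j ] 1                     ≡⟨ sum-cong-≗ (λ i → sym (∑-δ (f i))) ⟩
  ∑[ i < j ] ∑[ w < n ] δ w (f i)  ≡⟨ ∑-comm (λ i w → δ w (f i)) ⟩
  ∑[ w < n ] ∑[ i < j ] δ w (f i)  ≤⟨ sum-mono-≤ preimages≤ ⟩
  count p                          ∎
  where
  open ≤-Reasoning
  preimages≤ : ∀ w → ∑[ i < j ] δ w (f i) ≤ 𝟙 (p w)
  preimages≤ w with p w in pw
  ... | true  = count-unique (λ i → does (w ≟ f i))
                  (λ i i′ e e′ → f-inj (trans (sym (≟-does⇒≡ {x = w} e)) (≟-does⇒≡ {x = w} e′)))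
  ... | false = ≤-reflexive (count-none (λ i → does (w ≟ f i))
                  (λ i → dec-false (w ≟ f i) (λ { refl → contradiction (trans (sym pw) (p∘f i)) λ () })))

listSum-tabulate : ∀ {n} (f : Fin n → ℕ) → List.sum (tabulate f) ≡ sum f
listSum-tabulate {zero}  f = refl
listSum-tabulate {suc n} f = cong (f zero +_) (listSum-tabulate (f ∘ suc))

listSum-allFin : ∀ {n} (f : Fin n → ℕ) → List.sum (map f (allFin n)) ≡ sum f
listSum-allFin f = trans (cong List.sum (map-tabulate id f)) (listSum-tabulate f)

degree≡count : ∀ {n} (G : Graph n) v → degree G v ≡ count (adj G v)
degree≡count G v = listSum-allFin (𝟙 ∘ adj G v)

F≡∑degree³ : ∀ {n} (G : Graph n) → F G ≡ ∑[ v < n ] (degree G v ^ 3)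
F≡∑degree³ G = listSum-allFin (λ v → degree G v ^ 3)

degree-≅ : ∀ {n} {G H : Graph n} ((σ , σ-adj) : G ≅ H) v → degree G v ≡ degree H (σ ⟨$⟩ʳ v)
degree-≅ {n} {G} {H} (σ , σ-adj) v = begin
  degree G v                                ≡⟨ degree≡count G v ⟩
  ∑[ w < n ] 𝟙 (adj G v w)                  ≡⟨ sum-cong-≗ (cong 𝟙 ∘ σ-adj v) ⟩
  ∑[ w < n ] 𝟙 (adj H (σ ⟨$⟩ʳ v) (σ ⟨$⟩ʳ w)) ≡⟨ ∑-permute (𝟙 ∘ adj H (σ ⟨$⟩ʳ v)) σ ⟨
  count (adj H (σ ⟨$⟩ʳ v))                  ≡⟨ degree≡count H _ ⟨
  degree H (σ ⟨$⟩ʳ v)                       ∎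
  where open ≡-Reasoning

F-≅ : ∀ {n} {G H : Graph n} → G ≅ H → F G ≡ F H
F-≅ {n} {G} {H} G≅H@(σ , _) = begin
  F G                                  ≡⟨ F≡∑degree³ G ⟩
  ∑[ v < n ] (degree G v ^ 3)          ≡⟨ sum-cong-≗ (cong (_^ 3) ∘ degree-≅ {G = G} {H} G≅H) ⟩
  ∑[ v < n ] (degree H (σ ⟨$⟩ʳ v) ^ 3) ≡⟨ ∑-permute (λ v → degree H v ^ 3) σ ⟨
  ∑[ v < n ] (degree H v ^ 3)          ≡⟨ F≡∑degree³ H ⟨
  F H                                  ∎
  where open ≡-Reasoning

adj-sym : ∀ {n} (G : Graph n) {a b} → adj G a b ≡ true → adj G b a ≡ true
adj-sym G {a} {b} ab = trans (Graph.sym G b a) ab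

adj⇒≢ : ∀ {n} (G : Graph n) {a b} → adj G a b ≡ true → a ≢ b
adj⇒≢ G {a} ab refl = contradiction (trans (sym ab) (irrefl G a)) λ ()

1≤degree⇒neighbour : ∀ {n} (G : Graph n) v → 1 ≤ degree G v → Σ (Fin n) λ a → adj G v a ≡ true
1≤degree⇒neighbour G v 1≤d = count≥1⇒∃ (adj G v) (≤-trans 1≤d (≤-reflexive (degree≡count G v)))

neighbour⇒1≤degree : ∀ {n} (G : Graph n) {v a} → adj G v a ≡ true → 1 ≤ degree G v
neighbour⇒1≤degree G {v} {a} va = begin
  1                  ≡⟨ cong 𝟙 va ⟨
  𝟙 (adj G v a)      ≤⟨ term≤sum (𝟙 ∘ adj G v) a ⟩
  count (adj G v)    ≡⟨ degree≡count G v ⟨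
  degree G v         ∎
  where open ≤-Reasoning

neighbours⇒2≤degree : ∀ {n} (G : Graph n) {v a b} → a ≢ b →
  adj G v a ≡ true → adj G v b ≡ true → 2 ≤ degree G v
neighbours⇒2≤degree G {v} {a} {b} a≢b va vb =
  ≤-trans (injection⇒≤count (adj G v) (a Vec.∷ b Vec.∷ Vec.[]) injective adjacent)
          (≤-reflexive (sym (degree≡count G v)))
  where
  injective : Injective _≡_ _≡_ (a Vec.∷ b Vec.∷ Vec.[])
  injective {zero}      {zero}      _ = refl
  injective {zero}      {suc zero}  e = contradiction e a≢b
  injective {suc zero}  {zero}      e = contradiction (sym e) a≢b
  injective {suc zero}  {suc zero}  _ = refl
  adjacent : ∀ i → adj G v ((a Vec.∷ b Vec.∷ Vec.[]) i) ≡ true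
  adjacent zero       = va
  adjacent (suc zero) = vb

degree≤1⇒unique-neighbour : ∀ {n} (G : Graph n) {v a b} → degree G v ≤ 1 →
  adj G v a ≡ true → adj G v b ≡ true → a ≡ b
degree≤1⇒unique-neighbour G {a = a} {b} d≤1 va vb with a ≟ b
... | yes a≡b = a≡b
... | no  a≢b = contradiction (≤-trans (neighbours⇒2≤degree G a≢b va vb) d≤1) (<-irrefl refl)

degree≤2⇒neighbours : ∀ {n} (G : Graph n) {v a b c} → degree G v ≤ 2 → a ≢ b →
  adj G v a ≡ true → adj G v b ≡ true → adj G v c ≡ true → c ≡ a ⊎ c ≡ b
degree≤2⇒neighbours G {v} {a} {b} {c} d≤2 a≢b va vb vc with c ≟ a | c ≟ b
... | yes c≡a | _       = inj₁ c≡a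
... | no _    | yes c≡b = inj₂ c≡b
... | no c≢a  | no c≢b  = contradiction (≤-trans three≤degree d≤2) (<-irrefl refl)
  where
  injective : Injective _≡_ _≡_ (a Vec.∷ b Vec.∷ c Vec.∷ Vec.[])
  injective {zero}           {zero}           _ = refl
  injective {zero}           {suc zero}       e = contradiction e a≢b
  injective {zero}           {suc (suc zero)} e = contradiction (sym e) c≢a
  injective {suc zero}       {zero}           e = contradiction (sym e) a≢b
  injective {suc zero}       {suc zero}       _ = refl
  injective {suc zero}       {suc (suc zero)} e = contradiction (sym e) c≢b
  injective {suc (suc zero)} {zero}           e = contradiction e c≢a
  injective {suc (suc zero)} {suc zero}       e = contradiction e c≢b
  injective {suc (suc zero)} {suc (suc zero)} _ = refl
  adjacent : ∀ i → adj G v ((a Vec.∷ b Vec.∷ c Vec.∷ Vec.[]) i) ≡ true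
  adjacent zero             = va
  adjacent (suc zero)       = vb
  adjacent (suc (suc zero)) = vc
  three≤degree : 3 ≤ degree G v
  three≤degree = ≤-trans (injection⇒≤count (adj G v) (a Vec.∷ b Vec.∷ c Vec.∷ Vec.[]) injective adjacent)
                          (≤-reflexive (sym (degree≡count G v)))

isolated-edge : ∀ {n} (G : Graph n) {u z} → degree G u ≤ 1 → degree G z ≤ 1 → adj G z u ≡ true →
  ∀ {w} → Reach G u w → w ≡ u ⊎ w ≡ z
isolated-edge G {u} {z} u≤1 z≤1 zu = go (inj₁ refl)
  where
  go : ∀ {x w} → x ≡ u ⊎ x ≡ z → Reach G x w → w ≡ u ⊎ w ≡ z
  go x∈uz          here           = x∈uz
  go (inj₁ refl)   (step ul reach) = go (inj₂ (degree≤1⇒unique-neighbour G u≤1 ul (adj-sym G zu))) reach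
  go (inj₂ refl)   (step zl reach) = go (inj₁ (degree≤1⇒unique-neighbour G z≤1 zl zu)) reach

connected⇒1≤degree : ∀ {n} (G : Graph n) → Connected G → 2 ≤ n → ∀ v → 1 ≤ degree G v
connected⇒1≤degree {suc zero} G _ (s≤s ()) _
connected⇒1≤degree {suc (suc _)} G connected _ zero with connected zero (suc zero)
... | step vw _ = neighbour⇒1≤degree G vw
connected⇒1≤degree {suc (suc _)} G connected _ (suc v) with connected (suc v) zero
... | step vw _ = neighbour⇒1≤degree G vw

lookup-injective : ∀ {A : Set} {xs : List A} → Unique xs →
  ∀ i j → lookup xs i ≡ lookup xs j → i ≡ j
lookup-injective (_ ∷ _) zero zero _ = refl
lookup-injective (x∉xs ∷ _) zero (suc j) e = contradiction e (All.lookup x∉xs (∈-lookup j))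
lookup-injective (x∉xs ∷ _) (suc i) zero e = contradiction (sym e) (All.lookup x∉xs (∈-lookup i))
lookup-injective (_ ∷ xs-unique) (suc i) (suc j) e = cong suc (lookup-injective xs-unique i j e)

module _ {n} {E : Fin n → Fin n → Set} where
  open import Data.List.Membership.DecPropositional (_≟_ {n}) using (_∈?_)

  vertices : ∀ {x z} → Star E x z → List (Fin n)
  vertices {x} ε       = x ∷ []
  vertices {x} (_ ◅ w) = x ∷ vertices w

  SimplePath : Fin n → Fin n → Set
  SimplePath x z = Σ (Star E x z) (Unique ∘ vertices)

  suffix-from : ∀ {x y z} (p : Star E y z) → x ∈ vertices p → Unique (vertices p) → SimplePath x z
  suffix-from ε       (here refl) p-unique       = ε , p-unique
  suffix-from (e ◅ p) (here refl) p-unique       = e ◅ p , p-unique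
  suffix-from (e ◅ p) (there x∈p) (_ ∷ p-unique) = suffix-from p x∈p p-unique

  loop-erase : ∀ {x z} → Star E x z → SimplePath x z
  loop-erase ε = ε , All.[] ∷ []
  loop-erase {x} (e ◅ w) with loop-erase w
  ... | p , p-unique with x ∈? vertices p
  ... | yes x∈p = suffix-from p x∈p p-unique
  ... | no  x∉p = e ◅ p , ¬Any⇒All¬ _ x∉p ∷ p-unique

  lookup-vertices-first : ∀ {x z} (w : Star E x z) i → toℕ i ≡ 0 → lookup (vertices w) i ≡ x
  lookup-vertices-first ε       zero _ = refl
  lookup-vertices-first (_ ◅ _) zero _ = refl

  lookup-vertices-last : ∀ {x z} (w : Star E x z) i →
    suc (toℕ i) ≡ length (vertices w) → lookup (vertices w) i ≡ z
  lookup-vertices-last ε             zero    _ = refl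
  lookup-vertices-last (_ ◅ ε)       zero    ()
  lookup-vertices-last (_ ◅ _ ◅ _)   zero    ()
  lookup-vertices-last (_ ◅ w)       (suc i) i-last = lookup-vertices-last w i (suc-injective i-last)

  lookup-vertices-step : ∀ {x z} (w : Star E x z) i j →
    toℕ j ≡ suc (toℕ i) → E (lookup (vertices w) i) (lookup (vertices w) j)
  lookup-vertices-step ε       zero    zero    ()
  lookup-vertices-step (e ◅ w) zero    (suc j) j≡1   =
    subst (E _) (sym (lookup-vertices-first w j (suc-injective j≡1))) e
  lookup-vertices-step (_ ◅ w) (suc i) (suc j) j≡i+1 = lookup-vertices-step w i j (suc-injective j≡i+1)

OtherEdge : ∀ {n} → Graph n → Fin n → Fin n → Fin n → Fin n → Set
OtherEdge K u v s t = adj K s t ≡ true × (s , t) ≢ (u , v) × (s , t) ≢ (v , u)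

cycle-through : ∀ {n} (K : Graph n) {u v} → adj K u v ≡ true → Star (OtherEdge K u v) v u → Cycle K
cycle-through K {u} {v} uv w with loop-erase w
... | p , p-unique = record
  { len    = length (vertices p)
  ; len≥3  = three≤length p
  ; vs     = lookup (vertices p)
  ; inj    = lookup-injective p-unique _ _
  ; closed = closed-walk
  }
  where
  three≤length : (q : Star (OtherEdge K u v) v u) → 3 ≤ length (vertices q)
  three≤length ε                     = contradiction (trans (sym uv) (irrefl K u)) λ ()
  three≤length ((_ , _ , vu≢vu) ◅ ε) = contradiction refl vu≢vu
  three≤length (_ ◅ _ ◅ ε)           = s≤s (s≤s (s≤s z≤n))
  three≤length (_ ◅ _ ◅ _ ◅ _)       = s≤s (s≤s (s≤s z≤n))
  closed-walk : ∀ i j → Consecutive (length (vertices p)) i j →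
    adj K (lookup (vertices p) i) (lookup (vertices p) j) ≡ true
  closed-walk i j (inj₁ j≡i+1) with (st , _) ← lookup-vertices-step p i j j≡i+1 = st
  closed-walk i j (inj₂ (i-last , j≡0))
    rewrite lookup-vertices-last p i i-last | lookup-vertices-first p j j≡0 = uv

-- Acyclic graphs have fewer edges than vertices

Along : ∀ {n} → List (Fin n × Fin n) → Fin n → Fin n → Set
Along P s t = (s , t) ∈ P ⊎ (t , s) ∈ P

along-∷ : ∀ {n} {P : List (Fin n × Fin n)} {e s t} → Along P s t → Along (e ∷ P) s t
along-∷ (inj₁ st∈P) = inj₁ (there st∈P)
along-∷ (inj₂ ts∈P) = inj₂ (there ts∈P)

fixedPoints : ∀ {n} → (Fin n → Fin n) → ℕ
fixedPoints f = count (λ x → does (f x ≟ x))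

-- Union-find: the classes of rep are joined by edges of P, and merging two classes along
-- a new edge keeps fixedPoints rep + length P constant; an edge inside a class would close
-- a cycle.
record Partition {n} (P : List (Fin n × Fin n)) : Set where
  field
    rep           : Fin n → Fin n
    rep-idem      : ∀ x → rep (rep x) ≡ rep x
    rep-connected : ∀ x y → rep x ≡ rep y → Star (Along P) x y
    classes+edges : fixedPoints rep + length P ≡ n

  classes≥1 : Fin n → 1 ≤ fixedPoints rep
  classes≥1 x = ≤-trans (≤-reflexive (cong 𝟙 (sym (dec-true (rep (rep x) ≟ rep x) (rep-idem x)))))
                        (term≤sum (λ y → 𝟙 (does (rep y ≟ y))) (rep x))

  edges<n : Fin n → length P < n
  edges<n x = ≤-trans (+-monoˡ-≤ (length P) (classes≥1 x)) (≤-reflexive classes+edges)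

discrete : ∀ {n} → Partition {n} []
discrete {n} = record
  { rep           = λ x → x
  ; rep-idem      = λ _ → refl
  ; rep-connected = λ { x .x refl → ε }
  ; classes+edges = trans (+-identityʳ _)
                      (trans (sum-cong-≗ {n} (λ x → cong 𝟙 (dec-true (x ≟ x) refl))) (∑-one n))
  }

module Merge {n} {P : List (Fin n × Fin n)} (ρ : Partition P) {u v : Fin n}
  (rep-u≢rep-v : Partition.rep ρ u ≢ Partition.rep ρ v) where
  open Partition ρ

  rep′ : Fin n → Fin n
  rep′ x = if does (rep x ≟ rep v) then rep u else rep x

  rep′-cases : ∀ x → (rep x ≡ rep v × rep′ x ≡ rep u) ⊎ (rep x ≢ rep v × rep′ x ≡ rep x)
  rep′-cases x with rep x ≟ rep v
  ... | yes x~v = inj₁ (x~v , refl)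
  ... | no  x≁v = inj₂ (x≁v , refl)

  rep′-rep : ∀ x → rep x ≢ rep v → rep′ (rep x) ≡ rep x
  rep′-rep x x≁v with rep′-cases (rep x)
  ... | inj₁ (rx~v , _)  = contradiction (trans (sym (rep-idem x)) rx~v) x≁v
  ... | inj₂ (_ , rx↦rx) = trans rx↦rx (rep-idem x)

  rep′-idem : ∀ x → rep′ (rep′ x) ≡ rep′ x
  rep′-idem x with rep′-cases x
  ... | inj₁ (_ , x↦u)   = trans (cong rep′ x↦u) (trans (rep′-rep u rep-u≢rep-v) (sym x↦u))
  ... | inj₂ (x≁v , x↦x) = trans (cong rep′ x↦x) (trans (rep′-rep x x≁v) (sym x↦x))

  private
    P′ : List (Fin n × Fin n)
    P′ = (u , v) ∷ P

    lift : ∀ {x y} → rep x ≡ rep y → Star (Along P′) x y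
    lift x~y = Star.map along-∷ (rep-connected _ _ x~y)

  rep′-connected : ∀ x y → rep′ x ≡ rep′ y → Star (Along P′) x y
  rep′-connected x y x~y with rep′-cases x | rep′-cases y
  ... | inj₁ (x~v , _)    | inj₁ (y~v , _)    = lift (trans x~v (sym y~v))
  ... | inj₁ (x~v , x↦u)  | inj₂ (_ , y↦y)    =
    lift x~v ◅◅ inj₂ (here refl) ◅ lift (trans (sym x↦u) (trans x~y y↦y))
  ... | inj₂ (_ , x↦x)    | inj₁ (y~v , y↦u)  =
    lift (trans (sym x↦x) (trans x~y y↦u)) ◅◅ inj₁ (here refl) ◅ lift (sym y~v)
  ... | inj₂ (_ , x↦x)    | inj₂ (_ , y↦y)    = lift (trans (sym x↦x) (trans x~y y↦y))

  fixed′+δ : ∀ x → 𝟙 (does (rep′ x ≟ x)) + δ x (rep v) ≡ 𝟙 (does (rep x ≟ x))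
  fixed′+δ x with rep′-cases x | x ≟ rep v
  ... | inj₁ (_ , x↦u) | yes refl
    rewrite x↦u | dec-false (rep u ≟ rep v) rep-u≢rep-v | dec-true (rep (rep v) ≟ rep v) (rep-idem v) = refl
  ... | inj₁ (x~v , x↦u) | no x≢rep-v
    rewrite x↦u | dec-false (rep u ≟ x) (λ { refl → rep-u≢rep-v (trans (sym (rep-idem u)) x~v) })
              | dec-false (rep x ≟ x) (λ x-fixed → x≢rep-v (trans (sym x-fixed) x~v)) = refl
  ... | inj₂ (x≁v , x↦x) | yes refl = contradiction (rep-idem v) x≁v
  ... | inj₂ (_ , x↦x)   | no _ rewrite x↦x = +-identityʳ _

  merged : Partition P′
  merged = record
    { rep           = rep′
    ; rep-idem      = rep′-idem
    ; rep-connected = rep′-connected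
    ; classes+edges = begin
        fixedPoints rep′ + suc (length P)
          ≡⟨ +-assoc _ 1 (length P) ⟨
        fixedPoints rep′ + 1 + length P
          ≡⟨ cong (λ c → fixedPoints rep′ + c + length P) (∑-δ (rep v)) ⟨
        fixedPoints rep′ + ∑[ x < n ] δ x (rep v) + length P
          ≡⟨ cong (_+ length P) (∑-distrib-+ (λ x → 𝟙 (does (rep′ x ≟ x))) (λ x → δ x (rep v))) ⟨
        ∑[ x < n ] (𝟙 (does (rep′ x ≟ x)) + δ x (rep v)) + length P
          ≡⟨ cong (_+ length P) (sum-cong-≗ {n} fixed′+δ) ⟩
        fixedPoints rep + length P
          ≡⟨ classes+edges ⟩
        n ∎
    }
    where open ≡-Reasoning

OrderedEdge : ∀ {n} → Graph n → Fin n × Fin n → Set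
OrderedEdge K (s , t) = adj K s t ≡ true × toℕ s < toℕ t

module _ {n} (K : Graph n) (acyclic : Cycle K → ⊥) where

  along⇒otherEdge : ∀ {u v P} → All (OrderedEdge K) P → All ((u , v) ≢_) P → toℕ u < toℕ v →
    ∀ {s t} → Along P s t → OtherEdge K u v s t
  along⇒otherEdge P-edges uv∉P u<v (inj₁ st∈P) with All.lookup P-edges st∈P
  ... | st , s<t = st , (λ st≡uv → All.lookup uv∉P st∈P (sym st≡uv)) , λ { refl → <-asym u<v s<t }
  along⇒otherEdge P-edges uv∉P u<v (inj₂ ts∈P) with All.lookup P-edges ts∈P
  ... | ts , t<s = adj-sym K ts , (λ { refl → <-asym u<v t<s }) , λ { refl → All.lookup uv∉P ts∈P refl }

  partition : (P : List (Fin n × Fin n)) → Unique P → All (OrderedEdge K) P → Partition P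
  partition []            _                    _                     = discrete
  partition ((u , v) ∷ P) (uv∉P ∷ P-unique) ((uv , u<v) ∷ P-edges) with partition P P-unique P-edges
  ... | ρ with Partition.rep ρ u ≟ Partition.rep ρ v
  ... | yes u~v = contradiction (cycle-through K uv walk) acyclic
    where
    walk : Star (OtherEdge K u v) v u
    walk = Star.map (along⇒otherEdge P-edges uv∉P u<v) (Partition.rep-connected ρ v u (sym u~v))
  ... | no  u≁v = Merge.merged ρ u≁v

orderedEdge? : ∀ {n} (K : Graph n) → Decidable (OrderedEdge K)
orderedEdge? K (s , t) = (adj K s t Bool.≟ true) ×-dec (s Fin.<? t)

edges : ∀ {n} → Graph n → List (Fin n × Fin n)
edges {n} K = filter (orderedEdge? K) (cartesianProduct (allFin n) (allFin n))

acyclic⇒edges<n : ∀ {n} (K : Graph n) → (Cycle K → ⊥) → Fin n → length (edges K) < n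
acyclic⇒edges<n {n} K acyclic =
  Partition.edges<n (partition K acyclic (edges K) edges-unique (all-filter (orderedEdge? K) pairs))
  where
  pairs : List (Fin n × Fin n)
  pairs = cartesianProduct (allFin n) (allFin n)
  edges-unique : Unique (edges K)
  edges-unique = Unique.filter⁺ (orderedEdge? K) (Unique.cartesianProduct⁺ (Unique.allFin⁺ n) (Unique.allFin⁺ n))

length-filter≡sum : ∀ {A : Set} {P : A → Set} (P? : Decidable P) xs →
  length (filter P? xs) ≡ List.sum (map (𝟙 ∘ does ∘ P?) xs)
length-filter≡sum P? []       = refl
length-filter≡sum P? (x ∷ xs) with does (P? x)
... | true  = cong suc (length-filter≡sum P? xs)
... | false = length-filter≡sum P? xs

sum-cartesianProduct : ∀ {A B : Set} (f : A × B → ℕ) xs ys →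
  List.sum (map f (cartesianProduct xs ys)) ≡ List.sum (map (λ x → List.sum (map (λ y → f (x , y)) ys)) xs)
sum-cartesianProduct f []       ys = refl
sum-cartesianProduct f (x ∷ xs) ys = begin
  List.sum (map f (map (x ,_) ys ++ cartesianProduct xs ys))
    ≡⟨ cong List.sum (map-++ f (map (x ,_) ys) _) ⟩
  List.sum (map f (map (x ,_) ys) ++ map f (cartesianProduct xs ys))
    ≡⟨ sum-++ (map f (map (x ,_) ys)) _ ⟩
  List.sum (map f (map (x ,_) ys)) + List.sum (map f (cartesianProduct xs ys))
    ≡⟨ cong₂ _+_ (cong List.sum (sym (map-∘ ys))) (sum-cartesianProduct f xs ys) ⟩
  List.sum (map (λ y → f (x , y)) ys) + List.sum (map (λ x → List.sum (map (λ y → f (x , y)) ys)) xs) ∎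
  where open ≡-Reasoning

module _ {n} (K : Graph n) where

  private
    ordered : Fin n → Fin n → ℕ
    ordered s t = 𝟙 (does (orderedEdge? K (s , t)))

  length-edges : length (edges K) ≡ ∑[ s < n ] ∑[ t < n ] ordered s t
  length-edges = begin
    length (edges K)
      ≡⟨ length-filter≡sum (orderedEdge? K) (cartesianProduct (allFin n) (allFin n)) ⟩
    List.sum (map (λ (s , t) → ordered s t) (cartesianProduct (allFin n) (allFin n)))
      ≡⟨ sum-cartesianProduct (λ (s , t) → ordered s t) (allFin n) (allFin n) ⟩
    List.sum (map (λ s → List.sum (map (ordered s) (allFin n))) (allFin n))
      ≡⟨ cong List.sum (map-cong (λ s → listSum-allFin (ordered s)) (allFin n)) ⟩
    List.sum (map (λ s → ∑[ t < n ] ordered s t) (allFin n))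
      ≡⟨ listSum-allFin (λ s → ∑[ t < n ] ordered s t) ⟩
    ∑[ s < n ] ∑[ t < n ] ordered s t ∎
    where open ≡-Reasoning

  adj≡ordered+ordered : ∀ s t → 𝟙 (adj K s t) ≡ ordered s t + ordered t s
  adj≡ordered+ordered s t with adj K s t in st
  ... | false rewrite trans (Graph.sym K t s) st = refl
  ... | true  rewrite trans (Graph.sym K t s) st with Fin.<-cmp s t
  ...   | tri< s<t _ t≮s rewrite dec-true (s Fin.<? t) s<t | dec-false (t Fin.<? s) t≮s = refl
  ...   | tri> s≮t _ t<s rewrite dec-false (s Fin.<? t) s≮t | dec-true (t Fin.<? s) t<s = refl
  ...   | tri≈ _ refl _  = contradiction (trans (sym st) (irrefl K s)) λ ()

  handshake : ∑[ v < n ] degree K v ≡ length (edges K) + length (edges K)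
  handshake = begin
    ∑[ s < n ] degree K s
      ≡⟨ sum-cong-≗ (degree≡count K) ⟩
    ∑[ s < n ] ∑[ t < n ] 𝟙 (adj K s t)
      ≡⟨ sum-cong-≗ (λ s → sum-cong-≗ (adj≡ordered+ordered s)) ⟩
    ∑[ s < n ] ∑[ t < n ] (ordered s t + ordered t s)
      ≡⟨ sum-cong-≗ (λ s → ∑-distrib-+ (ordered s) (λ t → ordered t s)) ⟩
    ∑[ s < n ] (∑[ t < n ] ordered s t + ∑[ t < n ] ordered t s)
      ≡⟨ ∑-distrib-+ (λ s → ∑[ t < n ] ordered s t) _ ⟩
    E + ∑[ s < n ] ∑[ t < n ] ordered t s
      ≡⟨ cong (E +_) (∑-comm (λ s t → ordered t s)) ⟩
    E + E
      ≡⟨ cong₂ _+_ length-edges length-edges ⟨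
    length (edges K) + length (edges K) ∎
    where
    open ≡-Reasoning
    E : ℕ
    E = ∑[ s < n ] ∑[ t < n ] ordered s t

acyclic-degree-sum : ∀ {n} (K : Graph n) → (Cycle K → ⊥) → Fin n →
  ∑[ v < n ] degree K v + 2 ≤ n + n
acyclic-degree-sum {n} K acyclic x = begin
  ∑[ v < n ] degree K v + 2   ≡⟨ cong (_+ 2) (handshake K) ⟩
  (e + e) + 2                 ≡⟨ trans (+-comm (e + e) 2) (cong suc (sym (+-suc e e))) ⟩
  suc e + suc e               ≤⟨ +-mono-≤ e<n e<n ⟩
  n + n                       ∎
  where
  open ≤-Reasoning
  e : ℕ
  e = length (edges K)
  e<n : e < n
  e<n = acyclic⇒edges<n K acyclic x

-- A unicyclic graph has at most as many edges as vertices

isEdge : ∀ {n} → Fin n → Fin n → Fin n → Fin n → Bool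
isEdge x y s t = (does (s ≟ x) ∧ does (t ≟ y)) ∨ (does (s ≟ y) ∧ does (t ≟ x))

isEdge-sym : ∀ {n} (x y s t : Fin n) → isEdge x y s t ≡ isEdge x y t s
isEdge-sym x y s t =
  trans (cong₂ _∨_ (∧-comm (does (s ≟ x)) _) (∧-comm (does (s ≟ y)) _)) (∨-comm (does (t ≟ y) ∧ does (s ≟ x)) _)

deleteEdge : ∀ {n} → Graph n → Fin n → Fin n → Graph n
deleteEdge G x y = record
  { adj    = λ s t → adj G s t ∧ not (isEdge x y s t)
  ; sym    = λ s t → cong₂ (λ a e → a ∧ not e) (Graph.sym G s t) (isEdge-sym x y s t)
  ; irrefl = λ s → cong (_∧ not (isEdge x y s s)) (irrefl G s)
  }

deleteEdge-removes : ∀ {n} (G : Graph n) x y {s t} → isEdge x y s t ≡ true →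
  adj (deleteEdge G x y) s t ≢ true
deleteEdge-removes G x y {s} {t} st=xy rewrite st=xy | ∧-comm (adj G s t) false = λ ()

cycle-deleteEdge : ∀ {n} {G : Graph n} {x y} → Cycle (deleteEdge G x y) → Cycle G
cycle-deleteEdge {G = G} c = record
  { len = len c ; len≥3 = len≥3 c ; vs = vs c ; inj = inj c
  ; closed = λ i j ij → ∧-true (closed c i j ij)
  }
  where
  ∧-true : ∀ {a b} → a ∧ b ≡ true → a ≡ true
  ∧-true {true} _ = refl

isEdge-self : ∀ {n} (x y : Fin n) → isEdge x y x y ≡ true
isEdge-self x y rewrite dec-true (x ≟ x) refl | dec-true (y ≟ y) refl = refl

isEdge-self˘ : ∀ {n} (x y : Fin n) → isEdge x y y x ≡ true
isEdge-self˘ x y rewrite dec-true (x ≟ x) refl | dec-true (y ≟ y) refl = ∨-zeroʳ _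

unicyclic⇒deleteEdge-acyclic : ∀ {n} {G : Graph n} → Unicyclic G → (c : Cycle G) →
  ∀ {i j} → Consecutive (len c) i j → Cycle (deleteEdge G (vs c i) (vs c j)) → ⊥
unicyclic⇒deleteEdge-acyclic {G = G} (_ , _ , unique) c {i} {j} ij c′
  with Equivalence.to (unique c (cycle-deleteEdge c′) (vs c i) (vs c j)) (i , j , ij , inj₁ (refl , refl))
... | i′ , j′ , i′j′ , inj₁ (i′↦x , j′↦y) =
  deleteEdge-removes G (vs c i) (vs c j) (isEdge-self (vs c i) (vs c j))
    (subst₂ (λ s t → adj (deleteEdge G (vs c i) (vs c j)) s t ≡ true) i′↦x j′↦y (closed c′ i′ j′ i′j′))
... | i′ , j′ , i′j′ , inj₂ (i′↦y , j′↦x) =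
  deleteEdge-removes G (vs c i) (vs c j) (isEdge-self˘ (vs c i) (vs c j))
    (subst₂ (λ s t → adj (deleteEdge G (vs c i) (vs c j)) s t ≡ true) i′↦y j′↦x (closed c′ i′ j′ i′j′))

degree-deleteEdge : ∀ {n} (G : Graph n) x y v →
  degree G v ≤ degree (deleteEdge G x y) v + (δ v x + δ v y)
degree-deleteEdge {n} G x y v = begin
  degree G v
    ≡⟨ degree≡count G v ⟩
  ∑[ w < n ] 𝟙 (adj G v w)
    ≤⟨ sum-mono-≤ pointwise ⟩
  ∑[ w < n ] (𝟙 (adj K v w) + (δ v x * δ w y + δ v y * δ w x))
    ≡⟨ ∑-distrib-+ (𝟙 ∘ adj K v) _ ⟩
  count (adj K v) + ∑[ w < n ] (δ v x * δ w y + δ v y * δ w x)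
    ≡⟨ cong (count (adj K v) +_) (∑-distrib-+ (λ w → δ v x * δ w y) _) ⟩
  count (adj K v) + (∑[ w < n ] (δ v x * δ w y) + ∑[ w < n ] (δ v y * δ w x))
    ≡⟨ cong₂ (λ a b → count (adj K v) + (a + b)) (pick x y) (pick y x) ⟩
  count (adj K v) + (δ v x + δ v y)
    ≡⟨ cong (_+ (δ v x + δ v y)) (degree≡count K v) ⟨
  degree K v + (δ v x + δ v y) ∎
  where
  open ≤-Reasoning
  K : Graph n
  K = deleteEdge G x y
  pointwise : ∀ w → 𝟙 (adj G v w) ≤ 𝟙 (adj K v w) + (δ v x * δ w y + δ v y * δ w x)
  pointwise w = ≤-trans (𝟙-∧-not (adj G v w) (isEdge x y v w)) (+-monoʳ-≤ (𝟙 (adj K v w))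
    (≤-trans (𝟙-∨ (does (v ≟ x) ∧ does (w ≟ y)) _)
             (≤-reflexive (cong₂ _+_ (𝟙-∧ (does (v ≟ x)) _) (𝟙-∧ (does (v ≟ y)) _)))))
  pick : ∀ a b → ∑[ w < n ] (δ v a * δ w b) ≡ δ v a
  pick a b = trans (∑-*ˡ (δ v a) (λ w → δ w b)) (trans (cong (δ v a *_) (∑-δ b)) (*-identityʳ (δ v a)))

consecutive-pair : ∀ {k} → 2 ≤ k → Σ (Fin k) λ i → Σ (Fin k) λ j → Consecutive k i j
consecutive-pair (s≤s (s≤s _)) = zero , suc zero , inj₁ refl

unicyclic-degree-sum : ∀ {n} (G : Graph n) → Unicyclic G → ∑[ v < n ] degree G v ≤ n + n
unicyclic-degree-sum {n} G U@(_ , c , _) with consecutive-pair (≤-trans (n≤1+n 2) (len≥3 c))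
... | i , j , ij = begin
  ∑[ v < n ] degree G v                                 ≤⟨ sum-mono-≤ (degree-deleteEdge G x y) ⟩
  ∑[ v < n ] (degree K v + (δ v x + δ v y))             ≡⟨ ∑-distrib-+ (degree K) _ ⟩
  ∑[ v < n ] degree K v + ∑[ v < n ] (δ v x + δ v y)    ≡⟨ cong (∑[ v < n ] degree K v +_) (∑-distrib-+ (λ v → δ v x) _) ⟩
  ∑[ v < n ] degree K v + (∑[ v < n ] δ v x + ∑[ v < n ] δ v y)
                                                        ≡⟨ cong₂ (λ a b → ∑[ v < n ] degree K v + (a + b)) (∑-δ x) (∑-δ y) ⟩
  ∑[ v < n ] degree K v + 2                             ≤⟨ acyclic-degree-sum K (unicyclic⇒deleteEdge-acyclic U c ij) x ⟩
  n + n                                                 ∎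
  where
  open ≤-Reasoning
  x y : Fin n
  x = vs c i
  y = vs c j
  K : Graph n
  K = deleteEdge G x y

-- The cube sum of a degree sequence

φ : ℕ → ℕ
φ e = e * e * e + 6 * (e * e) + 12 * e

cube-2+ : ∀ e → (2 + e) ^ 3 ≡ 8 + φ e
cube-2+ = expand
  where
  -- x ^ 3 unfolds to x * (x * (x * 1)); the ring solver is run on that form.
  expand : ∀ e → (2 + e) * ((2 + e) * ((2 + e) * 1)) ≡ 8 + (e * e * e + 6 * (e * e) + 12 * e)
  expand = solve-∀

φ-+ : ∀ a b → φ (a + b) ≡ φ a + φ b + (3 * (a * b) * (a + b) + 12 * (a * b))
φ-+ = expand
  where
  expand : ∀ a b → (a + b) * (a + b) * (a + b) + 6 * ((a + b) * (a + b)) + 12 * (a + b) ≡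
    (a * a * a + 6 * (a * a) + 12 * a) + (b * b * b + 6 * (b * b) + 12 * b) +
    (3 * (a * b) * (a + b) + 12 * (a * b))
  expand = solve-∀

φ-superadditive : ∀ a b → φ a + φ b + 12 * (a * b) ≤ φ (a + b)
φ-superadditive a b =
  ≤-trans (+-monoʳ-≤ (φ a + φ b) (m≤n+m (12 * (a * b)) (3 * (a * b) * (a + b)))) (≤-reflexive (sym (φ-+ a b)))

φ-+-≥ : ∀ a s → φ a + 12 * s ≤ φ (a + s)
φ-+-≥ a s = begin
  φ a + 12 * s                ≤⟨ +-monoʳ-≤ (φ a) (m≤n+m (12 * s) (s * s * s + 6 * (s * s))) ⟩
  φ a + φ s                   ≤⟨ m≤m+n (φ a + φ s) _ ⟩
  φ a + φ s + 12 * (a * s)    ≤⟨ φ-superadditive a s ⟩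
  φ (a + s)                   ∎
  where open ≤-Reasoning

φ-mono-≤ : ∀ {a b} → a ≤ b → φ a ≤ φ b
φ-mono-≤ {a} {b} a≤b = begin
  φ a                   ≤⟨ m≤m+n (φ a) _ ⟩
  φ a + 12 * (b ∸ a)    ≤⟨ φ-+-≥ a (b ∸ a) ⟩
  φ (a + (b ∸ a))       ≡⟨ cong φ (m+[n∸m]≡n a≤b) ⟩
  φ b                   ∎
  where open ≤-Reasoning

sum-φ≤φ-sum : ∀ {n} (e : Fin n → ℕ) → ∑[ v < n ] φ (e v) ≤ φ (sum e)
sum-φ≤φ-sum {zero}  e = z≤n
sum-φ≤φ-sum {suc n} e = begin
  φ (e zero) + ∑[ v < n ] φ (e (suc v))                    ≤⟨ +-monoʳ-≤ (φ (e zero)) (sum-φ≤φ-sum (e ∘ suc)) ⟩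
  φ (e zero) + φ (sum (e ∘ suc))                          ≤⟨ m≤m+n _ _ ⟩
  φ (e zero) + φ (sum (e ∘ suc)) + 12 * (e zero * sum (e ∘ suc)) ≤⟨ φ-superadditive (e zero) _ ⟩
  φ (e zero + sum (e ∘ suc))                              ∎
  where open ≤-Reasoning

7*+φ≤φ : ∀ r s → 7 * s + φ r ≤ φ (r + s)
7*+φ≤φ r s = begin
  7 * s + φ r   ≡⟨ +-comm (7 * s) (φ r) ⟩
  φ r + 7 * s   ≤⟨ +-monoʳ-≤ (φ r) (*-monoˡ-≤ s (m≤m+n 7 5)) ⟩
  φ r + 12 * s  ≤⟨ φ-+-≥ r s ⟩
  φ (r + s)     ∎
  where open ≤-Reasoning

7*+φ<φ : ∀ r s → 1 ≤ s → 7 * s + φ r < φ (r + s)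
7*+φ<φ r s 1≤s = begin-strict
  7 * s + φ r          <⟨ +-monoˡ-< (φ r) 7s<12s ⟩
  12 * s + φ r         ≡⟨ +-comm (12 * s) (φ r) ⟩
  φ r + 12 * s         ≤⟨ φ-+-≥ r s ⟩
  φ (r + s)            ∎
  where
  open ≤-Reasoning
  7s<12s : 7 * s < 12 * s
  7s<12s = begin-strict
    7 * s            <⟨ +-monoˡ-≤ (7 * s) (≤-trans 1≤s (m≤n*m s 5)) ⟩
    5 * s + 7 * s    ≡⟨ *-distribʳ-+ s 5 7 ⟨
    12 * s           ∎

module _ {k m n : ℕ} (k≤m : k ≤ m) (m≤n : m ≤ n) where

  private
    rearrange : 7 * m + φ (n ∸ m) ≡ 7 * k + (7 * (m ∸ k) + φ (n ∸ m))
    rearrange = trans (cong (λ x → 7 * x + φ (n ∸ m)) (sym (m+[n∸m]≡n k≤m)))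
                (trans (cong (_+ φ (n ∸ m)) (*-distribˡ-+ 7 k (m ∸ k))) (+-assoc (7 * k) _ _))

    n∸k≡ : n ∸ m + (m ∸ k) ≡ n ∸ k
    n∸k≡ = sym (trans (cong (_∸ k) (sym (m∸n+n≡m m≤n))) (+-∸-assoc (n ∸ m) k≤m))

  nonLeaves-tradeoff : 7 * m + φ (n ∸ m) ≤ 7 * k + φ (n ∸ k)
  nonLeaves-tradeoff = begin
    7 * m + φ (n ∸ m)                          ≡⟨ rearrange ⟩
    7 * k + (7 * (m ∸ k) + φ (n ∸ m))          ≤⟨ +-monoʳ-≤ (7 * k) (7*+φ≤φ (n ∸ m) (m ∸ k)) ⟩
    7 * k + φ (n ∸ m + (m ∸ k))                ≡⟨ cong (λ x → 7 * k + φ x) n∸k≡ ⟩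
    7 * k + φ (n ∸ k)                          ∎
    where open ≤-Reasoning

  nonLeaves-tradeoff-< : k < m → 7 * m + φ (n ∸ m) < 7 * k + φ (n ∸ k)
  nonLeaves-tradeoff-< k<m = begin-strict
    7 * m + φ (n ∸ m)                          ≡⟨ rearrange ⟩
    7 * k + (7 * (m ∸ k) + φ (n ∸ m))          <⟨ +-monoʳ-< (7 * k) (7*+φ<φ (n ∸ m) (m ∸ k) (m<n⇒0<n∸m k<m)) ⟩
    7 * k + φ (n ∸ m + (m ∸ k))                ≡⟨ cong (λ x → 7 * k + φ x) n∸k≡ ⟩
    7 * k + φ (n ∸ k)                          ∎
    where open ≤-Reasoning

degree-split : ∀ x → 1 ≤ x → x ≡ 1 + 𝟙 (2 ≤ᵇ x) + (x ∸ 2)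
degree-split (suc zero)    _ = refl
degree-split (suc (suc y)) _ = refl

cube-split : ∀ x → 1 ≤ x → x ^ 3 ≡ 1 + 7 * 𝟙 (2 ≤ᵇ x) + φ (x ∸ 2)
cube-split (suc zero)    _ = refl
cube-split (suc (suc y)) _ = cube-2+ y

φ-sum-tight⇒concentrated : ∀ {n} (e : Fin n → ℕ) → φ (sum e) ≤ ∑[ v < n ] φ (e v) →
  ∀ u v → u ≢ v → 1 ≤ e u → e v ≡ 0
φ-sum-tight⇒concentrated {n} e tight u v u≢v 1≤eᵤ = n≤0⇒n≡0 (begin
  e v      ≡⟨ cong (λ b → if b then 0 else e v) (dec-false (v ≟ u) (u≢v ∘ sym)) ⟨
  others v ≤⟨ term≤sum others v ⟩
  R        ≤⟨ m≤n*m R (e u) {{>-nonZero 1≤eᵤ}} ⟩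
  e u * R  ≡⟨ n≤0⇒n≡0 (*-cancelˡ-≤ 12 (+-cancelˡ-≤ (φ (e u) + φ R) _ 0 squeeze)) ⟩
  0        ∎)
  where
  open ≤-Reasoning
  others : Fin n → ℕ
  others w = if does (w ≟ u) then 0 else e w
  R : ℕ
  R = sum others
  φ-others : ∀ w → (if does (w ≟ u) then 0 else φ (e w)) ≡ φ (others w)
  φ-others w with does (w ≟ u)
  ... | true  = refl
  ... | false = refl
  squeeze : φ (e u) + φ R + 12 * (e u * R) ≤ φ (e u) + φ R + 0
  squeeze = begin
    φ (e u) + φ R + 12 * (e u * R)                          ≤⟨ φ-superadditive (e u) R ⟩
    φ (e u + R)                                             ≡⟨ cong φ (∑-split-at u e) ⟨
    φ (sum e)                                               ≤⟨ tight ⟩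
    ∑[ w < n ] φ (e w)                                      ≡⟨ ∑-split-at u (φ ∘ e) ⟩
    φ (e u) + ∑[ w < n ] (if does (w ≟ u) then 0 else φ (e w)) ≡⟨ cong (φ (e u) +_) (sum-cong-≗ φ-others) ⟩
    φ (e u) + ∑[ w < n ] φ (others w)                       ≤⟨ +-monoʳ-≤ (φ (e u)) (sum-φ≤φ-sum others) ⟩
    φ (e u) + φ R                                           ≡⟨ +-identityʳ _ ⟨
    φ (e u) + φ R + 0                                       ∎

module DegreeSequence {n} (d : Fin n → ℕ) (d≥1 : ∀ v → 1 ≤ d v) (∑d≤2n : sum d ≤ n + n) where

  nonLeaves : ℕ
  nonLeaves = count (λ v → 2 ≤ᵇ d v)

  private
    e : Fin n → ℕ
    e v = d v ∸ 2

    E X : ℕ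
    E = sum e
    X = ∑[ v < n ] φ (e v)

    m : ℕ
    m = nonLeaves

  sum-d : sum d ≡ n + m + E
  sum-d = begin
    sum d                                    ≡⟨ sum-cong-≗ (λ v → degree-split (d v) (d≥1 v)) ⟩
    ∑[ v < n ] (1 + 𝟙 (2 ≤ᵇ d v) + e v)      ≡⟨ ∑-distrib-+ (λ v → 1 + 𝟙 (2 ≤ᵇ d v)) e ⟩
    ∑[ v < n ] (1 + 𝟙 (2 ≤ᵇ d v)) + E        ≡⟨ cong (_+ E) (∑-distrib-+ (λ _ → 1) (λ v → 𝟙 (2 ≤ᵇ d v))) ⟩
    ∑[ v < n ] 1 + m + E                     ≡⟨ cong (λ t → t + m + E) (∑-one n) ⟩
    n + m + E                                ∎
    where open ≡-Reasoning

  sum-d³ : ∑[ v < n ] (d v ^ 3) ≡ n + 7 * m + X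
  sum-d³ = begin
    ∑[ v < n ] (d v ^ 3)
      ≡⟨ sum-cong-≗ (λ v → cube-split (d v) (d≥1 v)) ⟩
    ∑[ v < n ] (1 + 7 * 𝟙 (2 ≤ᵇ d v) + φ (e v))
      ≡⟨ ∑-distrib-+ (λ v → 1 + 7 * 𝟙 (2 ≤ᵇ d v)) (φ ∘ e) ⟩
    ∑[ v < n ] (1 + 7 * 𝟙 (2 ≤ᵇ d v)) + X
      ≡⟨ cong (_+ X) (∑-distrib-+ (λ _ → 1) (λ v → 7 * 𝟙 (2 ≤ᵇ d v))) ⟩
    ∑[ v < n ] 1 + ∑[ v < n ] (7 * 𝟙 (2 ≤ᵇ d v)) + X
      ≡⟨ cong₂ (λ a b → a + b + X) (∑-one n) (∑-*ˡ 7 (λ v → 𝟙 (2 ≤ᵇ d v))) ⟩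
    n + 7 * m + X ∎
    where open ≡-Reasoning

  E≤n∸m : E ≤ n ∸ m
  E≤n∸m = begin
    E              ≡⟨ m+n∸m≡n m E ⟨
    m + E ∸ m      ≤⟨ ∸-monoˡ-≤ m (+-cancelˡ-≤ n (m + E) n m+E≤n) ⟩
    n ∸ m          ∎
    where
    open ≤-Reasoning
    m+E≤n : n + (m + E) ≤ n + n
    m+E≤n = ≤-trans (≤-reflexive (trans (sym (+-assoc n m E)) (sym sum-d))) ∑d≤2n

  X≤φ[n∸m] : X ≤ φ (n ∸ m)
  X≤φ[n∸m] = ≤-trans (sum-φ≤φ-sum e) (φ-mono-≤ E≤n∸m)

  cube-sum-≤ : ∑[ v < n ] (d v ^ 3) ≤ n + (7 * m + φ (n ∸ m))
  cube-sum-≤ = begin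
    ∑[ v < n ] (d v ^ 3)      ≡⟨ sum-d³ ⟩
    n + 7 * m + X             ≤⟨ +-monoʳ-≤ (n + 7 * m) X≤φ[n∸m] ⟩
    n + 7 * m + φ (n ∸ m)     ≡⟨ +-assoc n _ _ ⟩
    n + (7 * m + φ (n ∸ m))   ∎
    where open ≤-Reasoning

  module _ {k} (k≤m : k ≤ nonLeaves) where

    private
      m≤n : nonLeaves ≤ n
      m≤n = count≤n (λ v → 2 ≤ᵇ d v)

    cube-sum-bound : ∑[ v < n ] (d v ^ 3) ≤ n + 7 * k + φ (n ∸ k)
    cube-sum-bound = begin
      ∑[ v < n ] (d v ^ 3)      ≤⟨ cube-sum-≤ ⟩
      n + (7 * m + φ (n ∸ m))   ≤⟨ +-monoʳ-≤ n (nonLeaves-tradeoff k≤m m≤n) ⟩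
      n + (7 * k + φ (n ∸ k))   ≡⟨ +-assoc n _ _ ⟨
      n + 7 * k + φ (n ∸ k)     ∎
      where open ≤-Reasoning

    cube-sum-tight : ∑[ v < n ] (d v ^ 3) ≡ n + 7 * k + φ (n ∸ k) →
      nonLeaves ≡ k × (∀ u v → u ≢ v → 3 ≤ d u → d v ≤ 2)
    cube-sum-tight tight = m≡k , at-most-one-hub
      where
      m≡k : m ≡ k
      m≡k with m≤n⇒m<n∨m≡n k≤m
      ... | inj₂ k≡m = sym k≡m
      ... | inj₁ k<m = contradiction tight (<⇒≢ (begin-strict
        ∑[ v < n ] (d v ^ 3)      ≤⟨ cube-sum-≤ ⟩
        n + (7 * m + φ (n ∸ m))   <⟨ +-monoʳ-< n (nonLeaves-tradeoff-< k≤m m≤n k<m) ⟩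
        n + (7 * k + φ (n ∸ k))   ≡⟨ +-assoc n _ _ ⟨
        n + 7 * k + φ (n ∸ k)     ∎))
        where open ≤-Reasoning
      X≡φ[n∸k] : X ≡ φ (n ∸ k)
      X≡φ[n∸k] = +-cancelˡ-≡ (n + 7 * k) X _
        (trans (cong (λ t → n + 7 * t + X) (sym m≡k)) (trans (sym sum-d³) tight))
      φE≤X : φ E ≤ X
      φE≤X = begin
        φ E          ≤⟨ φ-mono-≤ E≤n∸m ⟩
        φ (n ∸ m)    ≡⟨ cong (λ t → φ (n ∸ t)) m≡k ⟩
        φ (n ∸ k)    ≡⟨ X≡φ[n∸k] ⟨
        X            ∎
        where open ≤-Reasoning
      at-most-one-hub : ∀ u v → u ≢ v → 3 ≤ d u → d v ≤ 2
      at-most-one-hub u v u≢v 3≤dᵤ =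
        m∸n≡0⇒m≤n (φ-sum-tight⇒concentrated e φE≤X u v u≢v (∸-monoˡ-≤ 2 3≤dᵤ))

-- Consecutive k i j is, by definition, Consecutiveℕ k (toℕ i) (toℕ j).
Consecutiveℕ : ℕ → ℕ → ℕ → Set
Consecutiveℕ k a b = (b ≡ suc a) ⊎ (suc a ≡ k × b ≡ 0)

Gk1Base : ℕ → ℕ → ℕ → Set
Gk1Base k a b = (b ≡ suc a × b < k) ⊎ (a ≡ 0 × suc b ≡ k) ⊎ (a ≡ 0 × k ≤ b)

gk1base-sound : ∀ k a b → T (gk1base k a b) → Gk1Base k a b
gk1base-sound k a b t with Equivalence.to (T-∨ {(b ≡ᵇ suc a) ∧ (b <ᵇ k)}) t
... | inj₁ t₁ with p , q ← Equivalence.to (T-∧ {b ≡ᵇ suc a}) t₁ = inj₁ (≡ᵇ⇒≡ b (suc a) p , <ᵇ⇒< b k q)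
... | inj₂ t₂ with Equivalence.to (T-∨ {(a ≡ᵇ 0) ∧ (suc b ≡ᵇ k)}) t₂
...   | inj₁ t₃ with p , q ← Equivalence.to (T-∧ {a ≡ᵇ 0}) t₃ = inj₂ (inj₁ (≡ᵇ⇒≡ a 0 p , ≡ᵇ⇒≡ (suc b) k q))
...   | inj₂ t₃ with p , q ← Equivalence.to (T-∧ {a ≡ᵇ 0}) t₃ = inj₂ (inj₂ (≡ᵇ⇒≡ a 0 p , ≤ᵇ⇒≤ k b q))

gk1base-complete : ∀ k a b → Gk1Base k a b → T (gk1base k a b)
gk1base-complete k a b (inj₁ (p , q)) =
  Equivalence.from T-∨ (inj₁ (Equivalence.from T-∧ (≡⇒≡ᵇ b (suc a) p , <⇒<ᵇ q)))
gk1base-complete k a b (inj₂ (inj₁ (p , q))) =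
  Equivalence.from (T-∨ {(b ≡ᵇ suc a) ∧ (b <ᵇ k)}) (inj₂ (Equivalence.from T-∨
    (inj₁ (Equivalence.from T-∧ (≡⇒≡ᵇ a 0 p , ≡⇒≡ᵇ (suc b) k q)))))
gk1base-complete k a b (inj₂ (inj₂ (p , q))) =
  Equivalence.from (T-∨ {(b ≡ᵇ suc a) ∧ (b <ᵇ k)}) (inj₂ (Equivalence.from (T-∨ {(a ≡ᵇ 0) ∧ (suc b ≡ᵇ k)})
    (inj₂ (Equivalence.from T-∧ (≡⇒≡ᵇ a 0 p , ≤⇒≤ᵇ q)))))

-- adj (G[ k ,1]^ h n) i j reduces to gk1Adj k (toℕ i) (toℕ j).
gk1Adj : ℕ → ℕ → ℕ → Bool
gk1Adj k a b = gk1base k a b ∨ gk1base k b a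

gk1Adj⇔ : ∀ k a b → T (gk1Adj k a b) ⇔ (Gk1Base k a b ⊎ Gk1Base k b a)
gk1Adj⇔ k a b = mk⇔
  (Sum.map (gk1base-sound k a b) (gk1base-sound k b a) ∘ Equivalence.to (T-∨ {gk1base k a b}))
  (Equivalence.from T-∨ ∘ Sum.map (gk1base-complete k a b) (gk1base-complete k b a))

private
  positive : ∀ {k x} → 1 ≤ k → k ≤ x → x ≢ 0
  positive 1≤k k≤x refl = contradiction (≤-trans 1≤k k≤x) λ ()

gk1Adj-cycle : ∀ {k a b} → a < k → b < k →
  T (gk1Adj k a b) ⇔ (Consecutiveℕ k a b ⊎ Consecutiveℕ k b a)
gk1Adj-cycle {k} {a} {b} a<k b<k = mk⇔ (to ∘ Equivalence.to (gk1Adj⇔ k a b)) (Equivalence.from (gk1Adj⇔ k a b) ∘ from)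
  where
  to : Gk1Base k a b ⊎ Gk1Base k b a → Consecutiveℕ k a b ⊎ Consecutiveℕ k b a
  to (inj₁ (inj₁ (b≡1+a , _)))          = inj₁ (inj₁ b≡1+a)
  to (inj₁ (inj₂ (inj₁ (a≡0 , 1+b≡k)))) = inj₂ (inj₂ (1+b≡k , a≡0))
  to (inj₁ (inj₂ (inj₂ (_ , k≤b))))     = contradiction k≤b (<⇒≱ b<k)
  to (inj₂ (inj₁ (a≡1+b , _)))          = inj₂ (inj₁ a≡1+b)
  to (inj₂ (inj₂ (inj₁ (b≡0 , 1+a≡k)))) = inj₁ (inj₂ (1+a≡k , b≡0))
  to (inj₂ (inj₂ (inj₂ (_ , k≤a))))     = contradiction k≤a (<⇒≱ a<k)
  from : Consecutiveℕ k a b ⊎ Consecutiveℕ k b a → Gk1Base k a b ⊎ Gk1Base k b a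
  from (inj₁ (inj₁ b≡1+a))          = inj₁ (inj₁ (b≡1+a , b<k))
  from (inj₁ (inj₂ (1+a≡k , b≡0)))  = inj₂ (inj₂ (inj₁ (b≡0 , 1+a≡k)))
  from (inj₂ (inj₁ a≡1+b))          = inj₂ (inj₁ (a≡1+b , a<k))
  from (inj₂ (inj₂ (1+b≡k , a≡0)))  = inj₁ (inj₂ (inj₁ (a≡0 , 1+b≡k)))

gk1Adj-spoke : ∀ {k a b} → 1 ≤ k → a < k → k ≤ b → T (gk1Adj k a b) ⇔ a ≡ 0
gk1Adj-spoke {k} {a} {b} 1≤k a<k k≤b =
  mk⇔ (to ∘ Equivalence.to (gk1Adj⇔ k a b)) (λ a≡0 → Equivalence.from (gk1Adj⇔ k a b) (inj₁ (inj₂ (inj₂ (a≡0 , k≤b)))))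
  where
  to : Gk1Base k a b ⊎ Gk1Base k b a → a ≡ 0
  to (inj₁ (inj₁ (_ , b<k)))            = contradiction k≤b (<⇒≱ b<k)
  to (inj₁ (inj₂ (inj₁ (_ , 1+b≡k))))   = contradiction (≤-trans (≤-reflexive 1+b≡k) k≤b) (<-irrefl refl)
  to (inj₁ (inj₂ (inj₂ (a≡0 , _))))     = a≡0
  to (inj₂ (inj₁ (a≡1+b , _)))          = contradiction (≤-trans k≤b (≤-trans (n≤1+n b) (≤-reflexive (sym a≡1+b)))) (<⇒≱ a<k)
  to (inj₂ (inj₂ (inj₁ (b≡0 , _))))     = contradiction b≡0 (positive 1≤k k≤b)
  to (inj₂ (inj₂ (inj₂ (b≡0 , _))))     = contradiction b≡0 (positive 1≤k k≤b)

gk1Adj-leaves : ∀ {k a b} → 1 ≤ k → k ≤ a → k ≤ b → ¬ T (gk1Adj k a b)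
gk1Adj-leaves {k} {a} {b} 1≤k k≤a k≤b = no-edge ∘ Equivalence.to (gk1Adj⇔ k a b)
  where
  no-edge : Gk1Base k a b ⊎ Gk1Base k b a → ⊥
  no-edge (inj₁ (inj₁ (_ , b<k)))        = <⇒≱ b<k k≤b
  no-edge (inj₁ (inj₂ (inj₁ (a≡0 , _)))) = positive 1≤k k≤a a≡0
  no-edge (inj₁ (inj₂ (inj₂ (a≡0 , _)))) = positive 1≤k k≤a a≡0
  no-edge (inj₂ (inj₁ (_ , a<k)))        = <⇒≱ a<k k≤a
  no-edge (inj₂ (inj₂ (inj₁ (b≡0 , _)))) = positive 1≤k k≤b b≡0
  no-edge (inj₂ (inj₂ (inj₂ (b≡0 , _)))) = positive 1≤k k≤b b≡0

gk1Adj-sym : ∀ k a b → gk1Adj k a b ≡ gk1Adj k b a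
gk1Adj-sym k a b = ∨-comm (gk1base k a b) (gk1base k b a)

consecutiveℕ-unique : ∀ {k a b c} → b < k → c < k → Consecutiveℕ k a b → Consecutiveℕ k a c → b ≡ c
consecutiveℕ-unique b<k c<k (inj₁ b≡1+a)        (inj₁ c≡1+a)        = trans b≡1+a (sym c≡1+a)
consecutiveℕ-unique b<k c<k (inj₁ b≡1+a)        (inj₂ (1+a≡k , _))  = contradiction (trans b≡1+a 1+a≡k) (<⇒≢ b<k)
consecutiveℕ-unique b<k c<k (inj₂ (1+a≡k , _))  (inj₁ c≡1+a)        = contradiction (trans c≡1+a 1+a≡k) (<⇒≢ c<k)
consecutiveℕ-unique b<k c<k (inj₂ (_ , b≡0))    (inj₂ (_ , c≡0))    = trans b≡0 (sym c≡0)

consecutiveℕ-unique˘ : ∀ {k a a′ b} → Consecutiveℕ k a b → Consecutiveℕ k a′ b → a ≡ a′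
consecutiveℕ-unique˘ (inj₁ b≡1+a)       (inj₁ b≡1+a′)       = suc-injective (trans (sym b≡1+a) b≡1+a′)
consecutiveℕ-unique˘ (inj₁ b≡1+a)       (inj₂ (_ , b≡0))     = contradiction (trans (sym b≡1+a) b≡0) λ ()
consecutiveℕ-unique˘ (inj₂ (_ , b≡0))   (inj₁ b≡1+a′)        = contradiction (trans (sym b≡1+a′) b≡0) λ ()
consecutiveℕ-unique˘ (inj₂ (1+a≡k , _)) (inj₂ (1+a′≡k , _)) = suc-injective (trans 1+a≡k (sym 1+a′≡k))

consecutiveℕ-asym : ∀ {k a b} → 3 ≤ k → Consecutiveℕ k a b → ¬ Consecutiveℕ k b a
consecutiveℕ-asym {a = a} 3≤k (inj₁ refl)          (inj₁ a≡2+a)         = <-irrefl a≡2+a (m<n⇒m<1+n (n<1+n a))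
consecutiveℕ-asym         3≤k (inj₁ refl)          (inj₂ (2≡k , refl))  = <⇒≢ 3≤k 2≡k
consecutiveℕ-asym         3≤k (inj₂ (2≡k , refl))  (inj₁ refl)          = <⇒≢ 3≤k 2≡k
consecutiveℕ-asym         3≤k (inj₂ (1≡k , refl))  (inj₂ (_ , refl))    = <⇒≢ (≤-trans (s≤s (s≤s z≤n)) 3≤k) 1≡k

consecutiveℕ-exists : ∀ {k a} → a < k → Σ ℕ λ c → c < k × Consecutiveℕ k a c
consecutiveℕ-exists {k} {a} a<k with suc a <? k
... | yes 1+a<k = suc a , 1+a<k , inj₁ refl
... | no  1+a≮k = 0 , ≤-trans (s≤s z≤n) a<k , inj₂ (≤-antisym a<k (≮⇒≥ 1+a≮k) , refl)

pred≢consecutive : ∀ {k a c} → 3 ≤ k → 0 < a → Consecutiveℕ k a c → pred a ≢ c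
pred≢consecutive {a = a} _ _ (inj₁ c≡1+a) p≡c = <-irrefl (trans p≡c c≡1+a) (≤-<-trans pred[n]≤n (n<1+n a))
pred≢consecutive {k} {a} 3≤k 0<a (inj₂ (1+a≡k , c≡0)) p≡c = <⇒≢ 3≤k (begin
  2          ≡⟨ cong (2 +_) (trans p≡c c≡0) ⟨
  2 + pred a ≡⟨ cong (1 +_) (suc-pred a {{>-nonZero 0<a}}) ⟩
  1 + a      ≡⟨ 1+a≡k ⟩
  k          ∎)
  where open ≡-Reasoning

module _ {k : ℕ} (3≤k : 3 ≤ k) where

  private
    1≤k : 1 ≤ k
    1≤k = ≤-trans (s≤s z≤n) 3≤k

  hub-neighbours : ∀ j → T (gk1Adj k 0 j) ⇔ ((j ≡ 1 ⊎ j ≡ pred k) ⊎ k ≤ j)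
  hub-neighbours j with j <? k
  ... | no  j≮k = mk⇔ (λ _ → inj₂ (≮⇒≥ j≮k)) (λ _ → Equivalence.from (gk1Adj-spoke 1≤k 1≤k (≮⇒≥ j≮k)) refl)
  ... | yes j<k = mk⇔ (to ∘ Equivalence.to (gk1Adj-cycle 1≤k j<k)) (Equivalence.from (gk1Adj-cycle 1≤k j<k) ∘ from)
    where
    to : Consecutiveℕ k 0 j ⊎ Consecutiveℕ k j 0 → (j ≡ 1 ⊎ j ≡ pred k) ⊎ k ≤ j
    to (inj₁ (inj₁ j≡1))         = inj₁ (inj₁ j≡1)
    to (inj₁ (inj₂ (1≡k , _)))   = contradiction (≤-trans 3≤k (≤-reflexive (sym 1≡k))) λ { (s≤s ()) }
    to (inj₂ (inj₂ (1+j≡k , _))) = inj₁ (inj₂ (cong pred 1+j≡k))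
    from : (j ≡ 1 ⊎ j ≡ pred k) ⊎ k ≤ j → Consecutiveℕ k 0 j ⊎ Consecutiveℕ k j 0
    from (inj₁ (inj₁ j≡1))     = inj₁ (inj₁ j≡1)
    from (inj₁ (inj₂ j≡k-1))   = inj₂ (inj₂ (trans (cong suc j≡k-1) (suc-pred k {{>-nonZero 1≤k}}) , refl))
    from (inj₂ k≤j)            = contradiction k≤j (<⇒≱ j<k)

  cycle-neighbours : ∀ {a c} → 0 < a → a < k → c < k → Consecutiveℕ k a c →
    ∀ j → T (gk1Adj k a j) ⇔ (j ≡ pred a ⊎ j ≡ c)
  cycle-neighbours {a} {c} 0<a a<k c<k a→c j with j <? k
  ... | no  j≮k = mk⇔ (λ t → contradiction (Equivalence.to (gk1Adj-spoke 1≤k a<k (≮⇒≥ j≮k)) t) (>⇒≢ 0<a))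
                      (λ { (inj₁ refl) → contradiction (≤-<-trans pred[n]≤n a<k) j≮k
                         ; (inj₂ refl) → contradiction c<k j≮k })
  ... | yes j<k = mk⇔ (to ∘ Equivalence.to (gk1Adj-cycle a<k j<k)) (Equivalence.from (gk1Adj-cycle a<k j<k) ∘ from)
    where
    to : Consecutiveℕ k a j ⊎ Consecutiveℕ k j a → j ≡ pred a ⊎ j ≡ c
    to (inj₁ a→j)              = inj₂ (consecutiveℕ-unique j<k c<k a→j a→c)
    to (inj₂ (inj₁ a≡1+j))     = inj₁ (cong pred (sym a≡1+j))
    to (inj₂ (inj₂ (_ , a≡0))) = contradiction a≡0 (>⇒≢ 0<a)
    from : j ≡ pred a ⊎ j ≡ c → Consecutiveℕ k a j ⊎ Consecutiveℕ k j a
    from (inj₁ refl) = inj₂ (inj₁ (sym (suc-pred a {{>-nonZero 0<a}})))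
    from (inj₂ refl) = inj₁ a→c

  leaf-neighbours : ∀ {a} → k ≤ a → ∀ j → T (gk1Adj k a j) ⇔ j ≡ 0
  leaf-neighbours {a} k≤a j with j <? k
  ... | yes j<k = subst (λ b → T b ⇔ j ≡ 0) (gk1Adj-sym k j a) (gk1Adj-spoke 1≤k j<k k≤a)
  ... | no  j≮k = mk⇔ (λ t → contradiction t (gk1Adj-leaves 1≤k k≤a (≮⇒≥ j≮k)))
                      (λ { refl → contradiction 1≤k j≮k })

T-≡ᵇ-pair : ∀ j c₁ c₂ → T ((j ≡ᵇ c₁) ∨ (j ≡ᵇ c₂)) ⇔ (j ≡ c₁ ⊎ j ≡ c₂)
T-≡ᵇ-pair j c₁ c₂ = mk⇔
  (Sum.map (≡ᵇ⇒≡ j c₁) (≡ᵇ⇒≡ j c₂) ∘ Equivalence.to (T-∨ {j ≡ᵇ c₁}))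
  (Equivalence.from T-∨ ∘ Sum.map (≡⇒≡ᵇ j c₁) (≡⇒≡ᵇ j c₂))

𝟙-≡ᵇ : ∀ {b j c} → T b ⇔ j ≡ c → 𝟙 b ≡ 𝟙 (j ≡ᵇ c)
𝟙-≡ᵇ {j = j} {c} b⇔ = 𝟙-cong⇔ b⇔ (mk⇔ (≡ᵇ⇒≡ j c) (≡⇒≡ᵇ j c))

𝟙-≡ᵇ-pair : ∀ {b j c₁ c₂} → c₁ ≢ c₂ → T b ⇔ (j ≡ c₁ ⊎ j ≡ c₂) →
  𝟙 b ≡ 𝟙 (j ≡ᵇ c₁) + 𝟙 (j ≡ᵇ c₂)
𝟙-≡ᵇ-pair {j = j} {c₁} {c₂} c₁≢c₂ b⇔ =
  trans (𝟙-cong⇔ b⇔ (T-≡ᵇ-pair j c₁ c₂))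
        (𝟙-∨-disjoint (j ≡ᵇ c₁) _ λ t₁ t₂ → c₁≢c₂ (trans (sym (≡ᵇ⇒≡ j c₁ t₁)) (≡ᵇ⇒≡ j c₂ t₂)))

𝟙-≡ᵇ-pair-≤ᵇ : ∀ {b j c₁ c₂ k} → c₁ ≢ c₂ → c₁ < k → c₂ < k → T b ⇔ ((j ≡ c₁ ⊎ j ≡ c₂) ⊎ k ≤ j) →
  𝟙 b ≡ 𝟙 (j ≡ᵇ c₁) + 𝟙 (j ≡ᵇ c₂) + 𝟙 (k ≤ᵇ j)
𝟙-≡ᵇ-pair-≤ᵇ {b} {j} {c₁} {c₂} {k} c₁≢c₂ c₁<k c₂<k b⇔ = begin
  𝟙 b                                           ≡⟨ 𝟙-cong⇔ b⇔ triple⇔ ⟩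
  𝟙 (((j ≡ᵇ c₁) ∨ (j ≡ᵇ c₂)) ∨ (k ≤ᵇ j))         ≡⟨ 𝟙-∨-disjoint ((j ≡ᵇ c₁) ∨ (j ≡ᵇ c₂)) (k ≤ᵇ j) disjoint ⟩
  𝟙 ((j ≡ᵇ c₁) ∨ (j ≡ᵇ c₂)) + 𝟙 (k ≤ᵇ j)         ≡⟨ cong (_+ 𝟙 (k ≤ᵇ j)) (𝟙-≡ᵇ-pair c₁≢c₂ (T-≡ᵇ-pair j c₁ c₂)) ⟩
  𝟙 (j ≡ᵇ c₁) + 𝟙 (j ≡ᵇ c₂) + 𝟙 (k ≤ᵇ j)       ∎
  where
  open ≡-Reasoning
  triple⇔ : T (((j ≡ᵇ c₁) ∨ (j ≡ᵇ c₂)) ∨ (k ≤ᵇ j)) ⇔ ((j ≡ c₁ ⊎ j ≡ c₂) ⊎ k ≤ j)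
  triple⇔ = mk⇔
    (Sum.map (Equivalence.to (T-≡ᵇ-pair j c₁ c₂)) (≤ᵇ⇒≤ k j) ∘ Equivalence.to (T-∨ {(j ≡ᵇ c₁) ∨ (j ≡ᵇ c₂)}))
    (Equivalence.from T-∨ ∘ Sum.map (Equivalence.from (T-≡ᵇ-pair j c₁ c₂)) ≤⇒≤ᵇ)
  disjoint : T ((j ≡ᵇ c₁) ∨ (j ≡ᵇ c₂)) → T (k ≤ᵇ j) → ⊥
  disjoint t₁ t₂ with Equivalence.to (T-≡ᵇ-pair j c₁ c₂) t₁
  ... | inj₁ refl = <⇒≱ c₁<k (≤ᵇ⇒≤ k j t₂)
  ... | inj₂ refl = <⇒≱ c₂<k (≤ᵇ⇒≤ k j t₂)

∑-≡ᵇ : ∀ {n c} → c < n → ∑[ j < n ] 𝟙 (toℕ j ≡ᵇ c) ≡ 1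
∑-≡ᵇ {suc n} {zero}  _         = cong suc (sum-replicate-zero n)
∑-≡ᵇ {suc n} {suc c} (s≤s c<n) = ∑-≡ᵇ c<n

∑-≤ᵇ : ∀ n k → ∑[ j < n ] 𝟙 (k ≤ᵇ toℕ j) ≡ n ∸ k
∑-≤ᵇ zero    zero    = refl
∑-≤ᵇ zero    (suc k) = refl
∑-≤ᵇ (suc n) zero    = cong suc (∑-one n)
∑-≤ᵇ (suc n) (suc k) = trans (sum-cong-≗ {n} (λ j → cong 𝟙 (≤ᵇ-suc k (toℕ j)))) (∑-≤ᵇ n k)
  where
  ≤ᵇ-suc : ∀ a b → (suc a ≤ᵇ suc b) ≡ (a ≤ᵇ b)
  ≤ᵇ-suc zero    b = refl
  ≤ᵇ-suc (suc a) b = refl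

∑-<ᵇ : ∀ {n k} → k ≤ n → ∑[ j < n ] 𝟙 (toℕ j <ᵇ k) ≡ k
∑-<ᵇ {n}     {zero}  _         = sum-replicate-zero n
∑-<ᵇ {suc n} {suc k} (s≤s k≤n) = cong suc (∑-<ᵇ k≤n)

module Gk1 {k n : ℕ} (3≤k : 3 ≤ k) (k≤n : k ≤ n) where

  H : Graph n
  H = G[ k ,1]^ 3≤k n

  private
    1≤k : 1 ≤ k
    1≤k = ≤-trans (s≤s z≤n) 3≤k

    degree-H : ∀ v → degree H v ≡ ∑[ w < n ] 𝟙 (gk1Adj k (toℕ v) (toℕ w))
    degree-H = degree≡count H

  hub-degree : ∀ v → toℕ v ≡ 0 → degree H v ≡ 2 + (n ∸ k)
  hub-degree v v≡0 = begin
    degree H v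
      ≡⟨ degree-H v ⟩
    ∑[ w < n ] 𝟙 (gk1Adj k (toℕ v) (toℕ w))
      ≡⟨ sum-cong-≗ {n} pointwise ⟩
    ∑[ w < n ] (𝟙 (toℕ w ≡ᵇ 1) + 𝟙 (toℕ w ≡ᵇ pred k) + 𝟙 (k ≤ᵇ toℕ w))
      ≡⟨ ∑-distrib-+ {n} (λ w → 𝟙 (toℕ w ≡ᵇ 1) + 𝟙 (toℕ w ≡ᵇ pred k)) (λ w → 𝟙 (k ≤ᵇ toℕ w)) ⟩
    ∑[ w < n ] (𝟙 (toℕ w ≡ᵇ 1) + 𝟙 (toℕ w ≡ᵇ pred k)) + ∑[ w < n ] 𝟙 (k ≤ᵇ toℕ w)
      ≡⟨ cong₂ _+_ (∑-distrib-+ {n} (λ w → 𝟙 (toℕ w ≡ᵇ 1)) (λ w → 𝟙 (toℕ w ≡ᵇ pred k))) (∑-≤ᵇ n k) ⟩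
    ∑[ w < n ] 𝟙 (toℕ w ≡ᵇ 1) + ∑[ w < n ] 𝟙 (toℕ w ≡ᵇ pred k) + (n ∸ k)
      ≡⟨ cong₂ (λ a b → a + b + (n ∸ k)) (∑-≡ᵇ {n} (≤-trans 1<k k≤n)) (∑-≡ᵇ {n} (≤-trans k-1<k k≤n)) ⟩
    2 + (n ∸ k) ∎
    where
    open ≡-Reasoning
    1<k : 1 < k
    1<k = ≤-trans (s≤s (s≤s z≤n)) 3≤k
    k-1<k : pred k < k
    k-1<k = ≤-reflexive (suc-pred k {{>-nonZero 1≤k}})
    1≢k-1 : 1 ≢ pred k
    1≢k-1 1≡k-1 = <⇒≢ 3≤k (trans (cong suc 1≡k-1) (suc-pred k {{>-nonZero 1≤k}}))
    pointwise : ∀ (w : Fin n) →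
      𝟙 (gk1Adj k (toℕ v) (toℕ w)) ≡ 𝟙 (toℕ w ≡ᵇ 1) + 𝟙 (toℕ w ≡ᵇ pred k) + 𝟙 (k ≤ᵇ toℕ w)
    pointwise w = subst (λ a → 𝟙 (gk1Adj k a (toℕ w)) ≡ _) (sym v≡0)
      (𝟙-≡ᵇ-pair-≤ᵇ 1≢k-1 1<k k-1<k (hub-neighbours 3≤k (toℕ w)))

  cycle-degree : ∀ v → 0 < toℕ v → toℕ v < k → degree H v ≡ 2
  cycle-degree v 0<a a<k with consecutiveℕ-exists a<k
  ... | c , c<k , a→c = begin
    degree H v
      ≡⟨ degree-H v ⟩
    ∑[ w < n ] 𝟙 (gk1Adj k (toℕ v) (toℕ w))
      ≡⟨ sum-cong-≗ {n} pointwise ⟩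
    ∑[ w < n ] (𝟙 (toℕ w ≡ᵇ pred (toℕ v)) + 𝟙 (toℕ w ≡ᵇ c))
      ≡⟨ ∑-distrib-+ {n} (λ w → 𝟙 (toℕ w ≡ᵇ pred (toℕ v))) _ ⟩
    ∑[ w < n ] 𝟙 (toℕ w ≡ᵇ pred (toℕ v)) + ∑[ w < n ] 𝟙 (toℕ w ≡ᵇ c)
      ≡⟨ cong₂ _+_ (∑-≡ᵇ {n} (≤-trans (≤-<-trans pred[n]≤n a<k) k≤n)) (∑-≡ᵇ {n} (≤-trans c<k k≤n)) ⟩
    2 ∎
    where
    open ≡-Reasoning
    pointwise : ∀ (w : Fin n) →
      𝟙 (gk1Adj k (toℕ v) (toℕ w)) ≡ 𝟙 (toℕ w ≡ᵇ pred (toℕ v)) + 𝟙 (toℕ w ≡ᵇ c)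
    pointwise w = 𝟙-≡ᵇ-pair (pred≢consecutive 3≤k 0<a a→c) (cycle-neighbours 3≤k 0<a a<k c<k a→c (toℕ w))

  leaf-degree : ∀ v → k ≤ toℕ v → degree H v ≡ 1
  leaf-degree v k≤a = begin
    degree H v
      ≡⟨ degree-H v ⟩
    ∑[ w < n ] 𝟙 (gk1Adj k (toℕ v) (toℕ w))
      ≡⟨ sum-cong-≗ {n} (λ w → 𝟙-≡ᵇ (leaf-neighbours 3≤k k≤a (toℕ w))) ⟩
    ∑[ w < n ] 𝟙 (toℕ w ≡ᵇ 0)
      ≡⟨ ∑-≡ᵇ {n} (≤-trans 1≤k k≤n) ⟩
    1 ∎
    where open ≡-Reasoning

  cube-degree : ∀ v a → toℕ v ≡ a → degree H v ^ 3 ≡ φ (n ∸ k) * 𝟙 (a ≡ᵇ 0) + 8 * 𝟙 (a <ᵇ k) + 𝟙 (k ≤ᵇ a)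
  cube-degree v zero v↦0
    rewrite 𝟙-T (<⇒<ᵇ 1≤k) | 𝟙-¬T {k ≤ᵇ 0} (λ t → <⇒≱ 1≤k (≤ᵇ⇒≤ k 0 t)) = begin
      degree H v ^ 3          ≡⟨ cong (_^ 3) (hub-degree v v↦0) ⟩
      (2 + (n ∸ k)) ^ 3       ≡⟨ cube-2+ (n ∸ k) ⟩
      8 + φ (n ∸ k)           ≡⟨ trans (+-comm 8 _) (cong (_+ 8) (sym (*-identityʳ _))) ⟩
      φ (n ∸ k) * 1 + 8       ≡⟨ +-identityʳ _ ⟨
      φ (n ∸ k) * 1 + 8 + 0   ∎
    where open ≡-Reasoning
  cube-degree v (suc a) v↦a with suc a <? k
  ... | yes a<k
    rewrite 𝟙-T (<⇒<ᵇ a<k) | 𝟙-¬T {k ≤ᵇ suc a} (λ t → <⇒≱ a<k (≤ᵇ⇒≤ k (suc a) t)) | *-zeroʳ (φ (n ∸ k)) =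
    cong (_^ 3) (cycle-degree v (subst (0 <_) (sym v↦a) z<s) (subst (_< k) (sym v↦a) a<k))
  ... | no  a≮k
    rewrite 𝟙-¬T {suc a <ᵇ k} (λ t → a≮k (<ᵇ⇒< (suc a) k t)) | 𝟙-T (≤⇒≤ᵇ (≮⇒≥ a≮k)) | *-zeroʳ (φ (n ∸ k)) =
    cong (_^ 3) (leaf-degree v (subst (k ≤_) (sym v↦a) (≮⇒≥ a≮k)))

  F-Gk1 : F H ≡ n + 7 * k + φ (n ∸ k)
  F-Gk1 = begin
    F H
      ≡⟨ F≡∑degree³ H ⟩
    ∑[ v < n ] (degree H v ^ 3)
      ≡⟨ sum-cong-≗ {n} (λ v → cube-degree v (toℕ v) refl) ⟩
    ∑[ v < n ] (r * hub v + 8 * cyc v + leaf v)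
      ≡⟨ ∑-distrib-+ {n} (λ v → r * hub v + 8 * cyc v) leaf ⟩
    ∑[ v < n ] (r * hub v + 8 * cyc v) + ∑[ v < n ] leaf v
      ≡⟨ cong₂ _+_ (∑-distrib-+ {n} (λ v → r * hub v) _) (∑-≤ᵇ n k) ⟩
    ∑[ v < n ] (r * hub v) + ∑[ v < n ] (8 * cyc v) + (n ∸ k)
      ≡⟨ cong₂ (λ a b → a + b + (n ∸ k)) (∑-*ˡ r hub) (∑-*ˡ 8 cyc) ⟩
    r * ∑[ v < n ] hub v + 8 * ∑[ v < n ] cyc v + (n ∸ k)
      ≡⟨ cong₂ (λ a b → r * a + 8 * b + (n ∸ k)) (∑-≡ᵇ {n} (≤-trans 1≤k k≤n)) (∑-<ᵇ k≤n) ⟩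
    r * 1 + 8 * k + (n ∸ k)
      ≡⟨ rearrange k (n ∸ k) r ⟩
    k + (n ∸ k) + 7 * k + r
      ≡⟨ cong (λ m → m + 7 * k + r) (m+[n∸m]≡n k≤n) ⟩
    n + 7 * k + r ∎
    where
    open ≡-Reasoning
    r : ℕ
    r = φ (n ∸ k)
    hub cyc leaf : Fin n → ℕ
    hub v = 𝟙 (toℕ v ≡ᵇ 0)
    cyc v = 𝟙 (toℕ v <ᵇ k)
    leaf v = 𝟙 (k ≤ᵇ toℕ v)
    rearrange : ∀ k l r → r * 1 + 8 * k + l ≡ k + l + 7 * k + r
    rearrange = solve-∀

sucᶜ : ∀ {k} → Fin k → Fin k
sucᶜ {suc m} i with suc (toℕ i) <? suc m
... | yes i+1<k = fromℕ< i+1<k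
... | no  _     = zero

sucᶜ-consecutive : ∀ {k} (i : Fin k) → Consecutive k i (sucᶜ i)
sucᶜ-consecutive {suc m} i with suc (toℕ i) <? suc m
... | yes i+1<k = inj₁ (toℕ-fromℕ< i+1<k)
... | no  i+1≮k = inj₂ (≤-antisym (toℕ<n i) (≮⇒≥ i+1≮k) , refl)

consecutive⇒sucᶜ : ∀ {k} {i j : Fin k} → Consecutive k i j → j ≡ sucᶜ i
consecutive⇒sucᶜ {i = i} {j} i→j =
  toℕ-injective (consecutiveℕ-unique (toℕ<n j) (toℕ<n (sucᶜ i)) i→j (sucᶜ-consecutive i))

sucᶜ-injective : ∀ {k} → Injective _≡_ _≡_ (sucᶜ {k})
sucᶜ-injective {x = i} {i′} e =
  toℕ-injective (consecutiveℕ-unique˘ (sucᶜ-consecutive i) (subst (Consecutive _ i′) (sym e) (sucᶜ-consecutive i′)))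

predᶜ : ∀ {k} → Fin k → Fin k
predᶜ {suc m} zero    = fromℕ m
predᶜ {suc m} (suc i) = inject₁ i

predᶜ-consecutive : ∀ {k} (j : Fin k) → Consecutive k (predᶜ j) j
predᶜ-consecutive {suc m} zero    = inj₂ (cong suc (toℕ-fromℕ m) , refl)
predᶜ-consecutive {suc m} (suc i) = inj₁ (cong suc (sym (toℕ-inject₁ i)))

sucᶜ-predᶜ : ∀ {k} (j : Fin k) → sucᶜ (predᶜ j) ≡ j
sucᶜ-predᶜ j = sym (consecutive⇒sucᶜ (predᶜ-consecutive j))

predᶜ≢sucᶜ : ∀ {k} → 3 ≤ k → (j : Fin k) → predᶜ j ≢ sucᶜ j
predᶜ≢sucᶜ 3≤k j p≡s =
  consecutiveℕ-asym 3≤k (sucᶜ-consecutive j) (subst (λ i → Consecutive _ i j) p≡s (predᶜ-consecutive j))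

_+ᶜ_ : ∀ {k} → Fin k → ℕ → Fin k
i +ᶜ zero  = i
i +ᶜ suc t = sucᶜ (i +ᶜ t)

sucᶜ-+ᶜ : ∀ {k} (i : Fin k) t → sucᶜ i +ᶜ t ≡ sucᶜ (i +ᶜ t)
sucᶜ-+ᶜ i zero    = refl
sucᶜ-+ᶜ i (suc t) = cong sucᶜ (sucᶜ-+ᶜ i t)

+ᶜ-injective : ∀ {k} t → Injective _≡_ _≡_ (λ (i : Fin k) → i +ᶜ t)
+ᶜ-injective zero    e = e
+ᶜ-injective (suc t) e = +ᶜ-injective t (sucᶜ-injective e)

toℕ-+ᶜ : ∀ {k} (i : Fin k) t → toℕ i ≡ 0 → t < k → toℕ (i +ᶜ t) ≡ t
toℕ-+ᶜ i zero    i≡0 _   = i≡0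
toℕ-+ᶜ i (suc t) i≡0 t<k with sucᶜ-consecutive (i +ᶜ t)
... | inj₁ next≡     = trans next≡ (cong suc (toℕ-+ᶜ i t i≡0 (<⇒≤ t<k)))
... | inj₂ (last , _) = contradiction (trans (cong suc (sym (toℕ-+ᶜ i t i≡0 (<⇒≤ t<k)))) last) (<⇒≢ t<k)

rotate : ∀ {n} {G : Graph n} (c : Cycle G) → Fin (len c) → Cycle G
rotate c r = record
  { len    = len c
  ; len≥3  = len≥3 c
  ; vs     = vs c ∘ (_+ᶜ toℕ r)
  ; inj    = +ᶜ-injective (toℕ r) ∘ inj c
  ; closed = λ i j i→j → closed c _ _ (subst (Consecutive (len c) (i +ᶜ toℕ r))
      (trans (sym (sucᶜ-+ᶜ i (toℕ r))) (cong (_+ᶜ toℕ r) (sym (consecutive⇒sucᶜ i→j))))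
      (sucᶜ-consecutive (i +ᶜ toℕ r)))
  }

rotate-start-unique : ∀ {n} {G : Graph n} (c : Cycle G) r i → vs (rotate c r) i ≡ vs c r → toℕ i ≡ 0
rotate-start-unique c r i vᵢ≡vᵣ = trans (cong toℕ (+ᶜ-injective (toℕ r) (trans (inj c vᵢ≡vᵣ) (sym z+r≡r)))) toℕ-z
  where
  z : Fin (len c)
  z = fromℕ< (≤-trans (s≤s z≤n) (toℕ<n r))
  toℕ-z : toℕ z ≡ 0
  toℕ-z = toℕ-fromℕ< _
  z+r≡r : z +ᶜ toℕ r ≡ r
  z+r≡r = toℕ-injective (toℕ-+ᶜ z (toℕ r) toℕ-z (toℕ<n r))

-- Extending an injection to a permutation

transpose-matchˡ : ∀ {n} (x y : Fin n) → PC.transpose x y x ≡ y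
transpose-matchˡ x y rewrite dec-true (x ≟ x) refl = refl

transpose-fix : ∀ {n} {x y z : Fin n} → z ≢ x → z ≢ y → PC.transpose x y z ≡ z
transpose-fix {x = x} {y} {z} z≢x z≢y rewrite dec-false (z ≟ x) z≢x | dec-false (z ≟ y) z≢y = refl

permutation-injective : ∀ {n} (π : Permutation′ n) → Injective _≡_ _≡_ (π ⟨$⟩ʳ_)
permutation-injective π {x} {y} e = trans (sym (inverseˡ π)) (trans (cong (π ⟨$⟩ˡ_) e) (inverseˡ π))

module _ {k n} (k≤n : k ≤ n) (f : Fin k → Fin n) (f-injective : Injective _≡_ _≡_ f) where

  private
    embed : Fin k → Fin n
    embed a = inject≤ a k≤n

    embed-injective : Injective _≡_ _≡_ embed
    embed-injective {a} {b} e =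
      toℕ-injective (trans (sym (toℕ-inject≤ a k≤n)) (trans (cong toℕ e) (toℕ-inject≤ b k≤n)))

    ExtendsBelow : ℕ → Set
    ExtendsBelow j = Σ (Permutation′ n) λ π → ∀ a → toℕ a < j → π ⟨$⟩ʳ embed a ≡ f a

    extend-below : ∀ j → j ≤ k → ExtendsBelow j
    extend-below zero    _   = idₚ , λ _ ()
    extend-below (suc j) j<k with extend-below j (<⇒≤ j<k)
    ... | π , agrees = π ∘ₚ transpose x y , agrees′
      where
      aⱼ : Fin k
      aⱼ = fromℕ< j<k
      x y : Fin n
      x = π ⟨$⟩ʳ embed aⱼ
      y = f aⱼ
      agrees′ : ∀ a → toℕ a < suc j → PC.transpose x y (π ⟨$⟩ʳ embed a) ≡ f a
      agrees′ a a≤j with toℕ a ℕ.≟ j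
      ... | yes a≡j rewrite toℕ-injective {i = a} {j = aⱼ} (trans a≡j (sym (toℕ-fromℕ< j<k))) = transpose-matchˡ x y
      ... | no  a≢j rewrite agrees a (≤∧≢⇒< (s≤s⁻¹ a≤j) a≢j) = transpose-fix fa≢x fa≢y
        where
        a≢aⱼ : a ≢ aⱼ
        a≢aⱼ a≡aⱼ = a≢j (trans (cong toℕ a≡aⱼ) (toℕ-fromℕ< j<k))
        fa≢x : f a ≢ x
        fa≢x fa≡x = a≢aⱼ (embed-injective (permutation-injective π (trans (agrees a (≤∧≢⇒< (s≤s⁻¹ a≤j) a≢j)) fa≡x)))
        fa≢y : f a ≢ y
        fa≢y fa≡y = a≢aⱼ (f-injective fa≡y)

  extend-injection : Σ (Permutation′ n) λ π → ∀ a → π ⟨$⟩ʳ inject≤ a k≤n ≡ f a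
  extend-injection with extend-below k ≤-refl
  ... | π , agrees = π , λ a → agrees a (toℕ<n a)

-- Recognising G[ k ,1]^ n

OffCycle : ∀ {n} {G : Graph n} → Cycle G → Fin n → Set
OffCycle c v = ∀ i → vs c i ≢ v

on-cycle? : ∀ {n} {G : Graph n} (c : Cycle G) v → (Σ (Fin (len c)) λ i → vs c i ≡ v) ⊎ OffCycle c v
on-cycle? c v with any? (λ i → vs c i ≟ v)
... | yes on  = inj₁ on
... | no  off = inj₂ λ i vᵢ≡v → off (i , vᵢ≡v)

≡-from-T⇔ : ∀ {a b} → (a ≡ true → T b) → (T b → a ≡ true) → a ≡ b
≡-from-T⇔ to from = ⇔→≡ {z = true} (mk⇔ (Equivalence.to T-≡ ∘ to) (from ∘ Equivalence.from T-≡))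

module _ {n} {G : Graph n} (c : Cycle G) (i : Fin (len c)) where

  adj-sucᶜ : adj G (vs c i) (vs c (sucᶜ i)) ≡ true
  adj-sucᶜ = closed c i (sucᶜ i) (sucᶜ-consecutive i)

  adj-predᶜ : adj G (vs c i) (vs c (predᶜ i)) ≡ true
  adj-predᶜ = adj-sym G (closed c (predᶜ i) i (predᶜ-consecutive i))

  vs-sucᶜ≢predᶜ : vs c (sucᶜ i) ≢ vs c (predᶜ i)
  vs-sucᶜ≢predᶜ e = predᶜ≢sucᶜ (len≥3 c) i (sym (inj c e))

  cycle-degree≥2 : 2 ≤ degree G (vs c i)
  cycle-degree≥2 = neighbours⇒2≤degree G vs-sucᶜ≢predᶜ adj-sucᶜ adj-predᶜ

module Gk1Shape {n} (G : Graph n) (connected : Connected G) (c : Cycle G) (k≤n : len c ≤ n)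
  (1≤degree : ∀ v → 1 ≤ degree G v)
  (cycle≤2 : ∀ i → toℕ i ≢ 0 → degree G (vs c i) ≤ 2)
  (off-cycle≤1 : ∀ v → OffCycle c v → degree G v ≤ 1) where

  private
    k : ℕ
    k = len c
    3≤k : 3 ≤ k
    3≤k = len≥3 c
    V : Fin k → Fin n
    V = vs c

    hubIndex : Fin k
    hubIndex = fromℕ< (≤-trans (s≤s z≤n) 3≤k)

    hub : Fin n
    hub = V hubIndex

    toℕ-hubIndex : toℕ hubIndex ≡ 0
    toℕ-hubIndex = toℕ-fromℕ< _

  cycle-neighbour : ∀ i → toℕ i ≢ 0 → ∀ {z} → adj G (V i) z ≡ true → z ≡ V (sucᶜ i) ⊎ z ≡ V (predᶜ i)
  cycle-neighbour i i≢0 = degree≤2⇒neighbours G (cycle≤2 i i≢0) (vs-sucᶜ≢predᶜ c i) (adj-sucᶜ c i) (adj-predᶜ c i)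

  cycle-adjacent : ∀ i j → adj G (V i) (V j) ≡ true → j ≡ sucᶜ i ⊎ i ≡ sucᶜ j
  cycle-adjacent i j ij with toℕ i ℕ.≟ 0
  ... | no i≢0 with cycle-neighbour i i≢0 ij
  ...   | inj₁ Vj≡ = inj₁ (inj c Vj≡)
  ...   | inj₂ Vj≡ = inj₂ (trans (sym (sucᶜ-predᶜ i)) (cong sucᶜ (sym (inj c Vj≡))))
  cycle-adjacent i j ij | yes i≡0 with cycle-neighbour j j≢0 (adj-sym G ij)
    where
    j≢0 : toℕ j ≢ 0
    j≢0 j≡0 = adj⇒≢ G ij (cong V (toℕ-injective (trans i≡0 (sym j≡0))))
  ...   | inj₁ Vi≡ = inj₂ (inj c Vi≡)
  ...   | inj₂ Vi≡ = inj₁ (trans (sym (sucᶜ-predᶜ j)) (cong sucᶜ (sym (inj c Vi≡))))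

  off-cycle-neighbour : ∀ {u} → OffCycle c u → ∀ {z} → adj G z u ≡ true → z ≡ hub
  off-cycle-neighbour {u} u-off {z} zu with on-cycle? c z
  ... | inj₂ z-off with isolated-edge G (off-cycle≤1 u u-off) (off-cycle≤1 z z-off) zu (connected u hub)
  ...   | inj₁ hub≡u = contradiction hub≡u (u-off hubIndex)
  ...   | inj₂ hub≡z = contradiction hub≡z (z-off hubIndex)
  off-cycle-neighbour {u} u-off {z} zu | inj₁ (j , Vj≡z) with toℕ j ℕ.≟ 0
  ... | yes j≡0 = trans (sym Vj≡z) (cong V (toℕ-injective (trans j≡0 (sym toℕ-hubIndex))))
  ... | no  j≢0 with cycle-neighbour j j≢0 (subst (λ x → adj G x u ≡ true) (sym Vj≡z) zu)
  ...   | inj₁ u≡ = contradiction (sym u≡) (u-off (sucᶜ j))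
  ...   | inj₂ u≡ = contradiction (sym u≡) (u-off (predᶜ j))

  hub-adjacent : ∀ {u} → OffCycle c u → adj G hub u ≡ true
  hub-adjacent {u} u-off with 1≤degree⇒neighbour G u (1≤degree u)
  ... | z , uz = subst (λ x → adj G x u ≡ true) (off-cycle-neighbour u-off (adj-sym G uz)) (adj-sym G uz)

  private
    extension : Σ (Permutation′ n) λ π → ∀ i → π ⟨$⟩ʳ inject≤ i k≤n ≡ V i
    extension = extend-injection k≤n V (inj c)

    π : Permutation′ n
    π = proj₁ extension

    π-extends : ∀ i → π ⟨$⟩ʳ inject≤ i k≤n ≡ V i
    π-extends = proj₂ extension

    embedded : ∀ a → toℕ a < k → Σ (Fin k) λ i → inject≤ i k≤n ≡ a
    embedded a a<k = fromℕ< a<k , toℕ-injective (trans (toℕ-inject≤ _ k≤n) (toℕ-fromℕ< a<k))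

    π-off-cycle : ∀ a → k ≤ toℕ a → OffCycle c (π ⟨$⟩ʳ a)
    π-off-cycle a k≤a i Vi≡πa = <⇒≱ (toℕ<n i) (subst (k ≤_) toℕa≡i k≤a)
      where
      toℕa≡i : toℕ a ≡ toℕ i
      toℕa≡i = trans (cong toℕ (permutation-injective π (trans (sym Vi≡πa) (sym (π-extends i)))))
                     (toℕ-inject≤ i k≤n)

  cycle-adj : ∀ i j → adj G (V i) (V j) ≡ gk1Adj k (toℕ i) (toℕ j)
  cycle-adj i j = ≡-from-T⇔ (Equivalence.from gk1⇔ ∘ consecutive) adjacent
    where
    gk1⇔ : T (gk1Adj k (toℕ i) (toℕ j)) ⇔ (Consecutive k i j ⊎ Consecutive k j i)
    gk1⇔ = gk1Adj-cycle (toℕ<n i) (toℕ<n j)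
    consecutive : adj G (V i) (V j) ≡ true → Consecutive k i j ⊎ Consecutive k j i
    consecutive ij with cycle-adjacent i j ij
    ... | inj₁ j≡i⁺ = inj₁ (subst (Consecutive k i) (sym j≡i⁺) (sucᶜ-consecutive i))
    ... | inj₂ i≡j⁺ = inj₂ (subst (Consecutive k j) (sym i≡j⁺) (sucᶜ-consecutive j))
    adjacent : T (gk1Adj k (toℕ i) (toℕ j)) → adj G (V i) (V j) ≡ true
    adjacent t with Equivalence.to gk1⇔ t
    ... | inj₁ i→j = closed c i j i→j
    ... | inj₂ j→i = adj-sym G (closed c j i j→i)

  spoke-adj : ∀ i b → k ≤ toℕ b → adj G (V i) (π ⟨$⟩ʳ b) ≡ gk1Adj k (toℕ i) (toℕ b)
  spoke-adj i b k≤b = ≡-from-T⇔ (Equivalence.from gk1⇔ ∘ at-hub) from-hub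
    where
    gk1⇔ : T (gk1Adj k (toℕ i) (toℕ b)) ⇔ toℕ i ≡ 0
    gk1⇔ = gk1Adj-spoke (≤-trans (s≤s z≤n) 3≤k) (toℕ<n i) k≤b
    at-hub : adj G (V i) (π ⟨$⟩ʳ b) ≡ true → toℕ i ≡ 0
    at-hub ib = trans (cong toℕ (inj c (off-cycle-neighbour (π-off-cycle b k≤b) ib))) toℕ-hubIndex
    from-hub : T (gk1Adj k (toℕ i) (toℕ b)) → adj G (V i) (π ⟨$⟩ʳ b) ≡ true
    from-hub t = subst (λ x → adj G (V x) (π ⟨$⟩ʳ b) ≡ true)
      (toℕ-injective (trans toℕ-hubIndex (sym (Equivalence.to gk1⇔ t))))
      (hub-adjacent (π-off-cycle b k≤b))

  leaves-adj : ∀ a b → k ≤ toℕ a → k ≤ toℕ b → adj G (π ⟨$⟩ʳ a) (π ⟨$⟩ʳ b) ≡ gk1Adj k (toℕ a) (toℕ b)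
  leaves-adj a b k≤a k≤b = ≡-from-T⇔
    (λ ab → contradiction (sym (off-cycle-neighbour (π-off-cycle b k≤b) ab)) (π-off-cycle a k≤a hubIndex))
    (λ t → contradiction t (gk1Adj-leaves (≤-trans (s≤s z≤n) 3≤k) k≤a k≤b))

  π-adj : ∀ a b → adj G (π ⟨$⟩ʳ a) (π ⟨$⟩ʳ b) ≡ gk1Adj k (toℕ a) (toℕ b)
  π-adj a b with toℕ a ℕ.<? k | toℕ b ℕ.<? k
  ... | yes a<k | yes b<k with embedded a a<k | embedded b b<k
  ...   | i , refl | j , refl
    rewrite π-extends i | π-extends j | toℕ-inject≤ i k≤n | toℕ-inject≤ j k≤n = cycle-adj i j
  π-adj a b | yes a<k | no b≮k with embedded a a<k
  ...   | i , refl rewrite π-extends i | toℕ-inject≤ i k≤n = spoke-adj i b (≮⇒≥ b≮k)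
  π-adj a b | no a≮k | yes b<k with embedded b b<k
  ...   | j , refl rewrite π-extends j | toℕ-inject≤ j k≤n =
    trans (Graph.sym G _ _) (trans (spoke-adj j a (≮⇒≥ a≮k)) (gk1Adj-sym k (toℕ j) (toℕ a)))
  π-adj a b | no a≮k | no b≮k = leaves-adj a b (≮⇒≥ a≮k) (≮⇒≥ b≮k)

  ≅Gk1 : G ≅ G[ k ,1]^ 3≤k n
  ≅Gk1 = flip π , λ u v →
    trans (cong₂ (adj G) (sym (inverseʳ π)) (sym (inverseʳ π))) (π-adj (π ⟨$⟩ˡ u) (π ⟨$⟩ˡ v))

≤⇒≤ᵇ≡true : ∀ {m n} → m ≤ n → (m ≤ᵇ n) ≡ true
≤⇒≤ᵇ≡true = Equivalence.to T-≡ ∘′ ≤⇒≤ᵇ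

off-cycle-leaf : ∀ {n} {G : Graph n} (c : Cycle G) → count (λ v → 2 ≤ᵇ degree G v) ≤ len c →
  ∀ v → OffCycle c v → degree G v ≤ 1
off-cycle-leaf {n} {G} c nonLeaves≤k v v-off with 2 ≤? degree G v
... | no  d≱2 = ≤-pred (≰⇒> d≱2)
... | yes 2≤d = contradiction (≤-trans (injection⇒≤count _ (v Vec.∷ vs c) injective nonLeaf) nonLeaves≤k) (<-irrefl refl)
  where
  injective : Injective _≡_ _≡_ (v Vec.∷ vs c)
  injective {zero}  {zero}  _ = refl
  injective {zero}  {suc j} e = contradiction (sym e) (v-off j)
  injective {suc i} {zero}  e = contradiction e (v-off i)
  injective {suc i} {suc j} e = cong suc (inj c e)
  nonLeaf : ∀ i → (2 ≤ᵇ degree G ((v Vec.∷ vs c) i)) ≡ true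
  nonLeaf zero    = ≤⇒≤ᵇ≡true 2≤d
  nonLeaf (suc i) = ≤⇒≤ᵇ≡true (cycle-degree≥2 c i)

hub-choice : ∀ {n} {G : Graph n} (c : Cycle G) → (∀ v → OffCycle c v → degree G v ≤ 1) →
  (∀ u v → u ≢ v → 3 ≤ degree G u → degree G v ≤ 2) →
  Σ (Fin (len c)) λ r → ∀ i → vs c i ≢ vs c r → degree G (vs c i) ≤ 2
hub-choice {G = G} c leaf at-most-one-hub with any? (λ u → 3 ≤? degree G u)
... | no  no-hub = fromℕ< (≤-trans (s≤s z≤n) (len≥3 c)) , λ i _ → ≤-pred (≰⇒> (λ 3≤d → no-hub (vs c i , 3≤d)))
... | yes (u , 3≤dᵤ) with on-cycle? c u
...   | inj₁ (r , vᵣ≡u) = r , λ i vᵢ≢vᵣ → at-most-one-hub u (vs c i) (λ u≡vᵢ → vᵢ≢vᵣ (sym (trans vᵣ≡u u≡vᵢ))) 3≤dᵤ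
...   | inj₂ u-off      = contradiction (≤-trans 3≤dᵤ (leaf u u-off)) λ { (s≤s ()) }

≅Gk1-of-shape : ∀ {n} (G : Graph n) → Connected G → (c : Cycle G) (k≤n : len c ≤ n) →
  (∀ v → 1 ≤ degree G v) → count (λ v → 2 ≤ᵇ degree G v) ≤ len c →
  (∀ u v → u ≢ v → 3 ≤ degree G u → degree G v ≤ 2) → G ≅ G[ len c ,1]^ (len≥3 c) n
≅Gk1-of-shape G connected c k≤n 1≤degree nonLeaves≤k at-most-one-hub
  with r , others≤2 ← hub-choice c (off-cycle-leaf c nonLeaves≤k) at-most-one-hub =
  Gk1Shape.≅Gk1 G connected (rotate c r) k≤n 1≤degree
    (λ i i≢0 → others≤2 _ (i≢0 ∘′ rotate-start-unique c r i))
    (off-cycle-leaf (rotate c r) nonLeaves≤k)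

lemma7 : (n k : ℕ) (h : 3 ≤ k) → k ≤ n → (G : Graph n) →
    Unicyclic G → (c : Cycle G) → len c ≡ k →
    (F G ≤ F (G[ k ,1]^ h n)) × ((F G ≡ F (G[ k ,1]^ h n)) ⇔ (G ≅ G[ k ,1]^ h n))
lemma7 n .(len c) 3≤k k≤n G U@(connected , _) c refl = cube-bound , mk⇔ tight⇒≅ (F-≅ {G = G} {H})
  where
  1≤degree : ∀ v → 1 ≤ degree G v
  1≤degree = connected⇒1≤degree G connected (≤-trans (n≤1+n 2) (≤-trans 3≤k k≤n))
  open DegreeSequence (degree G) 1≤degree (unicyclic-degree-sum G U)
  open Gk1 3≤k k≤n using (H; F-Gk1)
  k≤nonLeaves : len c ≤ nonLeaves
  k≤nonLeaves = injection⇒≤count _ (vs c) (inj c) (λ i → ≤⇒≤ᵇ≡true (cycle-degree≥2 c i))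
  cube-bound : F G ≤ F H
  cube-bound = begin
    F G                               ≡⟨ F≡∑degree³ G ⟩
    ∑[ v < n ] (degree G v ^ 3)       ≤⟨ cube-sum-bound k≤nonLeaves ⟩
    n + 7 * len c + φ (n ∸ len c)     ≡⟨ F-Gk1 ⟨
    F H                               ∎
    where open ≤-Reasoning
  tight⇒≅ : F G ≡ F H → G ≅ H
  tight⇒≅ tight = ≅Gk1-of-shape G connected c k≤n 1≤degree (≤-reflexive (proj₁ shape)) (proj₂ shape)
    where
    shape : nonLeaves ≡ len c × (∀ u v → u ≢ v → 3 ≤ degree G u → degree G v ≤ 2)
    shape = cube-sum-tight k≤nonLeaves (trans (sym (F≡∑degree³ G)) (trans tight F-Gk1))
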